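{- Let $k\ge2$ and let $\mathfrak M=\mathbf D(C_3^k,\mathcal D_k)\oplus\mathbf D(C_7,\{0,1,3\})$. Then $\mathrm{Aut}(\mathfrak M)\cong S_k\ltimes(C_3^k\oplus C_7)$, where $C_3^k\oplus C_7$ is the group of translations and $S_k$ acts by permuting the $k$ coordinates from $C_3$ (fixing the $C_7$ coordinate).
   Context: $C_m=\mathbb Z/m\mathbb Z$, written additively. $\mathcal D_k=\{e_0,\ldots,e_k\}\subseteq C_3^k$ with $e_0=0$ and $e_i$ the $i$-th standard unit vector. For an abelian group $\mathsf G$ and $D\subseteq G$ with $0\in D$, $\mathbf D(\mathsf G,D)$ is the incidence structure whose points are the elements of $G$ and whose lines are the translates $b+D$, incidence being membership. For two such structures, $\mathbf D(\mathsf G_1,D_1)\oplus\mathbf D(\mathsf G_2,D_2):=\mathbf D(\mathsf G_1\oplus\mathsf G_2,(D_1\times\{0\})\cup(\{0\}\times D_2))$. $\mathbf D(C_7,\{0,1,3\})$ is the Fano plane. $\mathrm{Aut}$ denotes the automorphism group (pairs of bijections of points and lines preserving and reflecting incidence). -}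

module Defs where

open import Data.Nat using (ℕ; _+_; _∸_)
open import Data.Nat.DivMod using (_mod_)
open import Data.Fin using (Fin; toℕ; zero; suc)
open import Data.Fin.Permutation using (Permutation′; _⟨$⟩ʳ_; _⟨$⟩ˡ_; _∘ₚ_)
open import Data.Vec using (Vec; lookup; tabulate; replicate; zipWith; map)
open import Data.Product using (_×_; _,_; ∃-syntax)
open import Data.Sum using (_⊎_)
open import Relation.Binary.PropositionalEquality using (_≡_)
open import Function.Definitions using (Bijective)
open import Function.Bundles using (_⇔_)

_+₃_ : Fin 3 → Fin 3 → Fin 3
a +₃ b = (toℕ a + toℕ b) mod 3

-₃_ : Fin 3 → Fin 3
-₃ a = (3 ∸ toℕ a) mod 3

_+₇_ : Fin 7 → Fin 7 → Fin 7
a +₇ b = (toℕ a + toℕ b) mod 7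

-₇_ : Fin 7 → Fin 7
-₇ a = (7 ∸ toℕ a) mod 7

G : ℕ → Set
G k = Vec (Fin 3) k × Fin 7

_⊕_ : ∀ {k} → G k → G k → G k
(v , a) ⊕ (w , b) = zipWith _+₃_ v w , (a +₇ b)

⊖_ : ∀ {k} → G k → G k
⊖ (v , a) = map -₃_ v , -₇ a

unit : ∀ {k} → Fin k → Vec (Fin 3) k
unit i = tabulate (λ j → indicator i j)
  where
  indicator : ∀ {k} → Fin k → Fin k → Fin 3
  indicator zero zero = suc zero
  indicator zero (suc j) = zero
  indicator (suc i) zero = zero
  indicator (suc i) (suc j) = indicator i j

-- Membership in the base block D = (𝒟_k × {0}) ∪ ({0} × {0,1,3})
-- where 𝒟_k = {e_0 = 0, e_1, …, e_k}.
InD : ∀ {k} → G k → Set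
InD {k} (v , a) =
  ((v ≡ replicate k zero) × a ≡ zero)
  ⊎ (∃[ i ] (v ≡ unit i × a ≡ zero))
  ⊎ (v ≡ replicate k zero × (a ≡ zero ⊎ a ≡ suc zero ⊎ a ≡ suc (suc (suc zero))))

-- The incidence structure 𝔐 = D(C₃^k, 𝒟_k) ⊕ D(C₇, {0,1,3}):
-- points are elements of G k, the line b + D is indexed by b : G k
-- (distinct b give distinct translates here),
-- and p is incident with b + D iff p - b ∈ D.
Point Line : ℕ → Set
Point k = G k
Line k = G k

Incident : ∀ {k} → Point k → Line k → Set
Incident p b = InD (p ⊕ (⊖ b))

IsAut : ∀ {k} → (Point k → Point k) → (Line k → Line k) → Set
IsAut f g =
  Bijective _≡_ _≡_ f × Bijective _≡_ _≡_ g
  × (∀ p l → Incident p l ⇔ Incident (f p) (g l))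

-- Action of S_k on C₃^k ⊕ C₇ by permuting the C₃ coordinates:
-- (σ · v)_{σ(i)} = v_i, C₇ coordinate fixed.
act : ∀ {k} → Permutation′ k → G k → G k
act σ (v , a) = tabulate (λ j → lookup v (σ ⟨$⟩ˡ j)) , a

SD : ℕ → Set
SD k = Permutation′ k × G k

-- (σ , t) · (τ , u) = (σ ∘ τ , t + σ·u)   (σ ∘ τ : apply τ first)
_·SD_ : ∀ {k} → SD k → SD k → SD k
(σ , t) ·SD (τ , u) = (τ ∘ₚ σ) , (t ⊕ act σ u)

_≈SD_ : ∀ {k} → SD k → SD k → Set
(σ , t) ≈SD (τ , u) = (∀ i → σ ⟨$⟩ʳ i ≡ τ ⟨$⟩ʳ i) × t ≡ u

Φpt : ∀ {k} → SD k → Point k → Point k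
Φpt (σ , t) x = act σ x ⊕ t

Φln : ∀ {k} → SD k → Line k → Line k
Φln (σ , t) b = act σ b ⊕ t

-- For surjectivity let
-- (f, g) be an automorphism.  On each line b + D the point b + f₁ is the only
-- "isolated" point (it has a collinear witness seeing no other point of the
-- line), so f (b + f₁) = g b + f₁.  Following the C₇-direction this forces
-- g = f and f (b + D r) = f b + D r for the non-unit roles r ∈ {0, f₁, f₃};
-- hence f permutes the unit points b + eᵢ of every line, by one permutation σ
-- independent of b.  Since G is generated by f₁ and the eᵢ, f = Φ(σ, f 0).
module Submission where

open import Defs
open import Data.Nat using (ℕ; zero; suc; _+_; _*_; pred; _≤_; _<_)
open import Data.Nat.DivMod using (_%_; _/_; m≡m%n+[m/n]*n)
open import Data.Nat.Properties using (*-suc; ≤-refl; ≤-trans; ≤-pred; n≮0)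
open import Data.Fin using (Fin; zero; suc; toℕ)
open import Data.Fin.Properties using (all?) renaming (_≟_ to _≟ᶠ_)
open import Data.Vec using (Vec; []; _∷_; lookup; replicate; zipWith)
open import Data.Vec.Properties using (lookup-zipWith; lookup-replicate; lookup-map; lookup∘tabulate; tabulate∘lookup; tabulate-cong) renaming (≡-dec to Vec-≡-dec)
open import Data.Product.Properties using () renaming (≡-dec to ×-≡-dec)
open import Data.Vec.Relation.Binary.Pointwise.Inductive using (Pointwise; []; _∷_)
open import Data.Product using (_×_; _,_; proj₁; proj₂; ∃-syntax)
open import Data.Empty using (⊥; ⊥-elim)
open import Data.Sum using (_⊎_; inj₁; inj₂)
open import Data.Fin.Permutation using (Permutation′; _⟨$⟩ʳ_; _⟨$⟩ˡ_; _∘ₚ_; flip; inverseˡ; inverseʳ; permutation)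
open import Function using (_∘_)
open import Function.Bundles using (mk⇔; Equivalence)
open import Function.Definitions using (Bijective)
open import Relation.Nullary using (¬_; Dec; yes; no)
open import Relation.Nullary.Decidable using (map′; _→-dec_; from-yes)
open import Relation.Binary.PropositionalEquality

-- Deciding equations in an abelian group whose variables are annotated by
-- an order o ≥ 1 with o·x = ε.  A term normalises to one coefficient per
-- variable (-x is read as (o-1)·x, so no integers are needed); terms are
-- equal when their coefficients agree modulo the orders.
module AbelianGroupSolver
  {A : Set} (_∙_ : A → A → A) (ε : A) (inv : A → A)
  (assoc : ∀ x y z → (x ∙ y) ∙ z ≡ x ∙ (y ∙ z))
  (comm  : ∀ x y → x ∙ y ≡ y ∙ x)
  (idʳ   : ∀ x → x ∙ ε ≡ x)
  (invʳ  : ∀ x → x ∙ inv x ≡ ε)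
  where

  open ≡-Reasoning

  idˡ : ∀ x → ε ∙ x ≡ x
  idˡ x = trans (comm ε x) (idʳ x)

  interchange : ∀ a b c d → (a ∙ b) ∙ (c ∙ d) ≡ (a ∙ c) ∙ (b ∙ d)
  interchange a b c d = begin
    (a ∙ b) ∙ (c ∙ d)  ≡⟨ assoc a b (c ∙ d) ⟩
    a ∙ (b ∙ (c ∙ d))  ≡⟨ cong (a ∙_) (sym (assoc b c d)) ⟩
    a ∙ ((b ∙ c) ∙ d)  ≡⟨ cong (λ u → a ∙ (u ∙ d)) (comm b c) ⟩
    a ∙ ((c ∙ b) ∙ d)  ≡⟨ cong (a ∙_) (assoc c b d) ⟩
    a ∙ (c ∙ (b ∙ d))  ≡⟨ sym (assoc a c (b ∙ d)) ⟩
    (a ∙ c) ∙ (b ∙ d)  ∎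

  inv-unique : ∀ x y → x ∙ y ≡ ε → y ≡ inv x
  inv-unique x y xy≡ε = begin
    y                ≡⟨ sym (idʳ y) ⟩
    y ∙ ε            ≡⟨ cong (y ∙_) (sym (invʳ x)) ⟩
    y ∙ (x ∙ inv x)  ≡⟨ sym (assoc y x (inv x)) ⟩
    (y ∙ x) ∙ inv x  ≡⟨ cong (_∙ inv x) (trans (comm y x) xy≡ε) ⟩
    ε ∙ inv x        ≡⟨ idˡ (inv x) ⟩
    inv x            ∎

  inv-∙ : ∀ x y → inv (x ∙ y) ≡ inv x ∙ inv y
  inv-∙ x y = sym (inv-unique (x ∙ y) (inv x ∙ inv y)
    (trans (interchange x y (inv x) (inv y)) (trans (cong₂ _∙_ (invʳ x) (invʳ y)) (idʳ ε))))

  times : ℕ → A → A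
  times zero    x = ε
  times (suc n) x = x ∙ times n x

  times-+ : ∀ m n x → times (m + n) x ≡ times m x ∙ times n x
  times-+ zero    n x = sym (idˡ _)
  times-+ (suc m) n x = trans (cong (x ∙_) (times-+ m n x)) (sym (assoc x _ _))

  times-* : ∀ m n x → times m (times n x) ≡ times (m * n) x
  times-* zero    n x = refl
  times-* (suc m) n x = trans (cong (times n x ∙_) (times-* m n x)) (sym (times-+ n (m * n) x))

  times-ε : ∀ n → times n ε ≡ ε
  times-ε zero    = refl
  times-ε (suc n) = trans (idˡ _) (times-ε n)

  _annihilates_ : ℕ → A → Set
  zero  annihilates x = ⊥
  suc m annihilates x = times (suc m) x ≡ ε

  -- -x = (o-1)·x and n·x = (n mod o)·x for x annihilated by o
  negate : ℕ → ℕ → ℕ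
  negate o c = c * pred o

  reduce : ℕ → ℕ → ℕ
  reduce zero    c = c
  reduce (suc m) c = c % suc m

  times-negate : ∀ o c x → o annihilates x → times (negate o c) x ≡ inv (times c x)
  times-negate (suc m) c x o·x≡ε = inv-unique (times c x) _ (begin
    times c x ∙ times (c * m) x  ≡⟨ sym (times-+ c (c * m) x) ⟩
    times (c + c * m) x          ≡⟨ cong (λ n → times n x) (sym (*-suc c m)) ⟩
    times (c * suc m) x          ≡⟨ sym (times-* c (suc m) x) ⟩
    times c (times (suc m) x)    ≡⟨ cong (times c) o·x≡ε ⟩
    times c ε                    ≡⟨ times-ε c ⟩
    ε                            ∎)

  times-reduce : ∀ o c x → o annihilates x → times (reduce o c) x ≡ times c x
  times-reduce (suc m) c x o·x≡ε = sym (begin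
    times c x                                 ≡⟨ cong (λ n → times n x) (m≡m%n+[m/n]*n c (suc m)) ⟩
    times (c % o + (c / o) * o) x             ≡⟨ times-+ (c % o) _ x ⟩
    times (c % o) x ∙ times ((c / o) * o) x   ≡⟨ cong (times (c % o) x ∙_) (sym (times-* (c / o) o x)) ⟩
    times (c % o) x ∙ times (c / o) (times o x) ≡⟨ cong (λ u → times (c % o) x ∙ times (c / o) u) o·x≡ε ⟩
    times (c % o) x ∙ times (c / o) ε         ≡⟨ cong (times (c % o) x ∙_) (times-ε (c / o)) ⟩
    times (c % o) x ∙ ε                       ≡⟨ idʳ _ ⟩
    times (c % o) x                           ∎)
    where o = suc m

  data Expr (n : ℕ) : Set where
    var  : Fin n → Expr n
    ∅    : Expr n
    _⊞_  : Expr n → Expr n → Expr n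
    ⊟_   : Expr n → Expr n

  infixl 6 _⊞_
  infix  7 ⊟_

  ⟦_⟧ : ∀ {n} → Expr n → Vec A n → A
  ⟦ var i ⟧ ρ = lookup ρ i
  ⟦ ∅ ⟧     ρ = ε
  ⟦ a ⊞ b ⟧ ρ = ⟦ a ⟧ ρ ∙ ⟦ b ⟧ ρ
  ⟦ ⊟ a ⟧   ρ = inv (⟦ a ⟧ ρ)

  -- a normal form is a vector of coefficients, meaning Σᵢ cᵢ·xᵢ
  evalNF : ∀ {n} → Vec ℕ n → Vec A n → A
  evalNF []       []      = ε
  evalNF (c ∷ cs) (x ∷ ρ) = times c x ∙ evalNF cs ρ

  basis : ∀ {n} → Fin n → Vec ℕ n
  basis {suc n} zero    = 1 ∷ replicate n 0
  basis {suc n} (suc i) = 0 ∷ basis i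

  normalise : ∀ {n} → Vec ℕ n → Expr n → Vec ℕ n
  normalise os (var i) = basis i
  normalise os ∅       = replicate _ 0
  normalise os (a ⊞ b) = zipWith _+_ (normalise os a) (normalise os b)
  normalise os (⊟ a)   = zipWith negate os (normalise os a)

  reduced : ∀ {n} → Vec ℕ n → Expr n → Vec ℕ n
  reduced os e = zipWith reduce os (normalise os e)

  eval-zero : ∀ {n} (ρ : Vec A n) → evalNF (replicate n 0) ρ ≡ ε
  eval-zero []      = refl
  eval-zero (x ∷ ρ) = trans (idˡ _) (eval-zero ρ)

  eval-basis : ∀ {n} (i : Fin n) ρ → evalNF (basis i) ρ ≡ lookup ρ i
  eval-basis zero    (x ∷ ρ) = trans (cong₂ _∙_ (idʳ x) (eval-zero ρ)) (idʳ x)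
  eval-basis (suc i) (x ∷ ρ) = trans (idˡ _) (eval-basis i ρ)

  eval-add : ∀ {n} (c d : Vec ℕ n) ρ → evalNF (zipWith _+_ c d) ρ ≡ evalNF c ρ ∙ evalNF d ρ
  eval-add []       []       []      = sym (idʳ ε)
  eval-add (c ∷ cs) (d ∷ ds) (x ∷ ρ) =
    trans (cong₂ _∙_ (times-+ c d x) (eval-add cs ds ρ)) (interchange _ _ _ _)

  eval-negate : ∀ {n} {os : Vec ℕ n} (c : Vec ℕ n) {ρ} → Pointwise _annihilates_ os ρ →
                evalNF (zipWith negate os c) ρ ≡ inv (evalNF c ρ)
  eval-negate []       []                     = inv-unique ε ε (idʳ ε)
  eval-negate (c ∷ cs) {x ∷ ρ} (o·x≡ε ∷ ann) =
    trans (cong₂ _∙_ (times-negate _ c x o·x≡ε) (eval-negate cs ann)) (sym (inv-∙ _ _))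

  eval-reduce : ∀ {n} {os : Vec ℕ n} (c : Vec ℕ n) {ρ} → Pointwise _annihilates_ os ρ →
                evalNF (zipWith reduce os c) ρ ≡ evalNF c ρ
  eval-reduce []       []                     = refl
  eval-reduce (c ∷ cs) {x ∷ ρ} (o·x≡ε ∷ ann) =
    cong₂ _∙_ (times-reduce _ c x o·x≡ε) (eval-reduce cs ann)

  normalise-sound : ∀ {n} {os : Vec ℕ n} (e : Expr n) {ρ} → Pointwise _annihilates_ os ρ →
                    ⟦ e ⟧ ρ ≡ evalNF (normalise os e) ρ
  normalise-sound (var i) {ρ} ann = sym (eval-basis i ρ)
  normalise-sound ∅       {ρ} ann = sym (eval-zero ρ)
  normalise-sound {os = os} (a ⊞ b) {ρ} ann =
    trans (cong₂ _∙_ (normalise-sound a ann) (normalise-sound b ann))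
          (sym (eval-add (normalise os a) (normalise os b) ρ))
  normalise-sound {os = os} (⊟ a) ann =
    trans (cong inv (normalise-sound a ann)) (sym (eval-negate (normalise os a) ann))

  solve : ∀ {n} (os : Vec ℕ n) (e₁ e₂ : Expr n) → reduced os e₁ ≡ reduced os e₂ →
          ∀ ρ → Pointwise _annihilates_ os ρ → ⟦ e₁ ⟧ ρ ≡ ⟦ e₂ ⟧ ρ
  solve os e₁ e₂ same ρ ann = begin
    ⟦ e₁ ⟧ ρ                    ≡⟨ normalise-sound e₁ ann ⟩
    evalNF (normalise os e₁) ρ  ≡⟨ sym (eval-reduce (normalise os e₁) ann) ⟩
    evalNF (reduced os e₁) ρ    ≡⟨ cong (λ c → evalNF c ρ) same ⟩
    evalNF (reduced os e₂) ρ    ≡⟨ eval-reduce (normalise os e₂) ann ⟩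
    evalNF (normalise os e₂) ρ  ≡⟨ sym (normalise-sound e₂ ann) ⟩
    ⟦ e₂ ⟧ ρ                    ∎

+₃-assoc : ∀ a b c → (a +₃ b) +₃ c ≡ a +₃ (b +₃ c)
+₃-assoc = from-yes (all? λ a → all? λ b → all? λ c → ((a +₃ b) +₃ c) ≟ᶠ (a +₃ (b +₃ c)))

+₃-comm : ∀ a b → a +₃ b ≡ b +₃ a
+₃-comm = from-yes (all? λ a → all? λ b → (a +₃ b) ≟ᶠ (b +₃ a))

+₃-idʳ : ∀ a → a +₃ zero ≡ a
+₃-idʳ = from-yes (all? λ a → (a +₃ zero) ≟ᶠ a)

+₃-invʳ : ∀ a → a +₃ (-₃ a) ≡ zero
+₃-invʳ = from-yes (all? λ a → (a +₃ (-₃ a)) ≟ᶠ zero)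

+₇-assoc : ∀ a b c → (a +₇ b) +₇ c ≡ a +₇ (b +₇ c)
+₇-assoc = from-yes (all? λ a → all? λ b → all? λ c → ((a +₇ b) +₇ c) ≟ᶠ (a +₇ (b +₇ c)))

+₇-comm : ∀ a b → a +₇ b ≡ b +₇ a
+₇-comm = from-yes (all? λ a → all? λ b → (a +₇ b) ≟ᶠ (b +₇ a))

+₇-idʳ : ∀ a → a +₇ zero ≡ a
+₇-idʳ = from-yes (all? λ a → (a +₇ zero) ≟ᶠ a)

+₇-invʳ : ∀ a → a +₇ (-₇ a) ≡ zero
+₇-invʳ = from-yes (all? λ a → (a +₇ (-₇ a)) ≟ᶠ zero)

module C₃ = AbelianGroupSolver _+₃_ zero -₃_ +₃-assoc +₃-comm +₃-idʳ +₃-invʳ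
module C₇ = AbelianGroupSolver _+₇_ zero -₇_ +₇-assoc +₇-comm +₇-idʳ +₇-invʳ

C₃-exponent : ∀ a → C₃.times 3 a ≡ zero
C₃-exponent = from-yes (all? λ a → C₃.times 3 a ≟ᶠ zero)

C₃-exponent-21 : ∀ a → C₃.times 21 a ≡ zero
C₃-exponent-21 = from-yes (all? λ a → C₃.times 21 a ≟ᶠ zero)

C₇-exponent-21 : ∀ a → C₇.times 21 a ≡ zero
C₇-exponent-21 = from-yes (all? λ a → C₇.times 21 a ≟ᶠ zero)

vec-ext : ∀ {A : Set} {n} {v w : Vec A n} → (∀ j → lookup v j ≡ lookup w j) → v ≡ w
vec-ext {v = v} {w} p = trans (sym (tabulate∘lookup v)) (trans (tabulate-cong p) (tabulate∘lookup w))

module _ {k : ℕ} where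

  0G : G k
  0G = replicate k zero , zero

  coord : Fin k → G k → Fin 3
  coord j x = lookup (proj₁ x) j

  coord-⊕ : ∀ j (x y : G k) → coord j (x ⊕ y) ≡ coord j x +₃ coord j y
  coord-⊕ j x y = lookup-zipWith _+₃_ j (proj₁ x) (proj₁ y)

  coord-0 : ∀ j → coord j 0G ≡ zero
  coord-0 j = lookup-replicate j zero

  coord-ext : ∀ {x y : G k} → (∀ j → coord j x ≡ coord j y) → proj₂ x ≡ proj₂ y → x ≡ y
  coord-ext p q = cong₂ _,_ (vec-ext p) q

  ⊕-assoc : ∀ (x y z : G k) → (x ⊕ y) ⊕ z ≡ x ⊕ (y ⊕ z)
  ⊕-assoc x y z = coord-ext (λ j → begin
      coord j ((x ⊕ y) ⊕ z)               ≡⟨ coord-⊕ j (x ⊕ y) z ⟩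
      coord j (x ⊕ y) +₃ coord j z        ≡⟨ cong (_+₃ coord j z) (coord-⊕ j x y) ⟩
      (coord j x +₃ coord j y) +₃ coord j z ≡⟨ +₃-assoc (coord j x) (coord j y) (coord j z) ⟩
      coord j x +₃ (coord j y +₃ coord j z) ≡⟨ cong (coord j x +₃_) (sym (coord-⊕ j y z)) ⟩
      coord j x +₃ coord j (y ⊕ z)        ≡⟨ sym (coord-⊕ j x (y ⊕ z)) ⟩
      coord j (x ⊕ (y ⊕ z))               ∎)
    (+₇-assoc (proj₂ x) (proj₂ y) (proj₂ z))
    where open ≡-Reasoning

  ⊕-comm : ∀ (x y : G k) → x ⊕ y ≡ y ⊕ x
  ⊕-comm x y = coord-ext
    (λ j → trans (coord-⊕ j x y) (trans (+₃-comm (coord j x) (coord j y)) (sym (coord-⊕ j y x))))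
    (+₇-comm (proj₂ x) (proj₂ y))

  ⊕-idʳ : ∀ (x : G k) → x ⊕ 0G ≡ x
  ⊕-idʳ x = coord-ext
    (λ j → trans (coord-⊕ j x 0G) (trans (cong (coord j x +₃_) (coord-0 j)) (+₃-idʳ (coord j x))))
    (+₇-idʳ (proj₂ x))

  ⊕-invʳ : ∀ (x : G k) → x ⊕ (⊖ x) ≡ 0G
  ⊕-invʳ x = coord-ext
    (λ j → trans (coord-⊕ j x (⊖ x)) (trans (cong (coord j x +₃_) (lookup-map j -₃_ (proj₁ x)))
             (trans (+₃-invʳ (coord j x)) (sym (coord-0 j)))))
    (+₇-invʳ (proj₂ x))

module GroupG {k : ℕ} = AbelianGroupSolver (_⊕_ {k}) 0G ⊖_ ⊕-assoc ⊕-comm ⊕-idʳ ⊕-invʳ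

module _ {k : ℕ} where

  open GroupG {k} using (times; _annihilates_; Expr; var; _⊞_; ⊟_; ⟦_⟧; reduced)

  coord-times : ∀ n j (x : G k) → coord j (times n x) ≡ C₃.times n (coord j x)
  coord-times zero    j x = coord-0 j
  coord-times (suc n) j x = trans (coord-⊕ j x (times n x)) (cong (coord j x +₃_) (coord-times n j x))

  proj₂-times : ∀ n (x : G k) → proj₂ (times n x) ≡ C₇.times n (proj₂ x)
  proj₂-times zero    x = refl
  proj₂-times (suc n) x = cong (proj₂ x +₇_) (proj₂-times n x)

  times≡0 : ∀ n (x : G k) → (∀ j → C₃.times n (coord j x) ≡ zero) → C₇.times n (proj₂ x) ≡ zero →
            times n x ≡ 0G
  times≡0 n x c₃ c₇ = coord-ext (λ j → trans (coord-times n j x) (trans (c₃ j) (sym (coord-0 j))))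
                                (trans (proj₂-times n x) c₇)

  exponent-21 : ∀ (x : G k) → 21 annihilates x
  exponent-21 x = times≡0 21 x (λ j → C₃-exponent-21 (coord j x)) (C₇-exponent-21 (proj₂ x))

  f₁ f₃ : G k
  f₁ = replicate k zero , suc zero
  f₃ = replicate k zero , suc (suc (suc zero))

  u : Fin k → G k
  u i = unit i , zero

  f₁-order : 7 annihilates f₁
  f₁-order = times≡0 7 f₁ (λ j → cong (C₃.times 7) (coord-0 j)) refl

  u-order : ∀ i → 3 annihilates u i
  u-order i = times≡0 3 (u i) (λ j → C₃-exponent (coord j (u i))) refl

  f₃≡3f₁ : f₃ ≡ f₁ ⊕ (f₁ ⊕ f₁)
  f₃≡3f₁ = coord-ext (λ j → sym (begin
      coord j (f₁ ⊕ (f₁ ⊕ f₁))              ≡⟨ coord-⊕ j f₁ (f₁ ⊕ f₁) ⟩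
      coord j f₁ +₃ coord j (f₁ ⊕ f₁)       ≡⟨ cong (coord j f₁ +₃_) (coord-⊕ j f₁ f₁) ⟩
      coord j f₁ +₃ (coord j f₁ +₃ coord j f₁) ≡⟨ cong (λ a → a +₃ (a +₃ a)) (coord-0 j) ⟩
      zero                                  ≡⟨ sym (coord-0 j) ⟩
      coord j f₃                            ∎))
    refl
    where open ≡-Reasoning

  data Term (n : ℕ) : Set where
    x⟨_⟩  : Fin n → Term n
    ∅     : Term n
    _⊕'_  : Term n → Term n → Term n
    ⊖'_   : Term n → Term n
    F₁ F₃ : Term n

  infixl 6 _⊕'_
  infix  7 ⊖'_

  ⟪_⟫ : ∀ {n} → Term n → Vec (G k) n → G k
  ⟪ x⟨ i ⟩ ⟫ ρ = lookup ρ i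
  ⟪ ∅ ⟫      ρ = 0G
  ⟪ a ⊕' b ⟫ ρ = ⟪ a ⟫ ρ ⊕ ⟪ b ⟫ ρ
  ⟪ ⊖' a ⟫   ρ = ⊖ ⟪ a ⟫ ρ
  ⟪ F₁ ⟫     ρ = f₁
  ⟪ F₃ ⟫     ρ = f₃

  -- f₁ becomes an extra variable (of order 7), f₃ the term 3·f₁
  compile : ∀ {n} → Term n → Expr (suc n)
  compile x⟨ i ⟩  = var (suc i)
  compile ∅       = GroupG.∅ {k}
  compile (a ⊕' b) = compile a ⊞ compile b
  compile (⊖' a)  = ⊟ compile a
  compile F₁      = var zero
  compile F₃      = var zero ⊞ (var zero ⊞ var zero)

  compile-sound : ∀ {n} (e : Term n) ρ → ⟪ e ⟫ ρ ≡ ⟦ compile e ⟧ (f₁ ∷ ρ)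
  compile-sound x⟨ i ⟩  ρ = refl
  compile-sound ∅       ρ = refl
  compile-sound (a ⊕' b) ρ = cong₂ _⊕_ (compile-sound a ρ) (compile-sound b ρ)
  compile-sound (⊖' a)  ρ = cong ⊖_ (compile-sound a ρ)
  compile-sound F₁      ρ = refl
  compile-sound F₃      ρ = f₃≡3f₁

  solveᵗ : ∀ {n} (os : Vec ℕ n) (e₁ e₂ : Term n) →
           reduced (7 ∷ os) (compile e₁) ≡ reduced (7 ∷ os) (compile e₂) →
           ∀ ρ → Pointwise _annihilates_ os ρ → ⟪ e₁ ⟫ ρ ≡ ⟪ e₂ ⟫ ρ
  solveᵗ os e₁ e₂ same ρ ann =
    trans (compile-sound e₁ ρ)
          (trans (GroupG.solve {k} (7 ∷ os) (compile e₁) (compile e₂) same (f₁ ∷ ρ) (f₁-order ∷ ann))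
                 (sym (compile-sound e₂ ρ)))

  -- the common case: arbitrary elements, annihilated by the exponent 21
  generic : ∀ {n} (ρ : Vec (G k) n) → Pointwise _annihilates_ (replicate n 21) ρ
  generic []      = []
  generic (x ∷ ρ) = exponent-21 x ∷ generic ρ

  solve : ∀ {n} (e₁ e₂ : Term n) →
          reduced (7 ∷ replicate n 21) (compile e₁) ≡ reduced (7 ∷ replicate n 21) (compile e₂) →
          ∀ ρ → ⟪ e₁ ⟫ ρ ≡ ⟪ e₂ ⟫ ρ
  solve e₁ e₂ same ρ = solveᵗ (replicate _ 21) e₁ e₂ same ρ (generic ρ)

  x₀ : ∀ {n} → Term (1 + n)
  x₀ = x⟨ zero ⟩
  x₁ : ∀ {n} → Term (2 + n)
  x₁ = x⟨ suc zero ⟩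
  x₂ : ∀ {n} → Term (3 + n)
  x₂ = x⟨ suc (suc zero) ⟩
  x₃ : ∀ {n} → Term (4 + n)
  x₃ = x⟨ suc (suc (suc zero)) ⟩

module _ where

  open ≡-Reasoning

  coord-u-same : ∀ {k} (i : Fin k) → coord i (u i) ≡ suc zero
  coord-u-same zero    = refl
  coord-u-same (suc i) = coord-u-same i

  coord-u-diff : ∀ {k} (i j : Fin k) → i ≢ j → coord j (u i) ≡ zero
  coord-u-diff zero    zero    i≢j = ⊥-elim (i≢j refl)
  coord-u-diff zero    (suc j) i≢j = lookup∘tabulate (λ _ → zero) j
  coord-u-diff (suc i) zero    i≢j = refl
  coord-u-diff (suc i) (suc j) i≢j = coord-u-diff i j (λ i≡j → i≢j (cong suc i≡j))

  coord-u-01 : ∀ {k} (i j : Fin k) → coord j (u i) ≡ zero ⊎ coord j (u i) ≡ suc zero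
  coord-u-01 i j with i ≟ᶠ j
  ... | yes refl = inj₂ (coord-u-same i)
  ... | no  i≢j  = inj₁ (coord-u-diff i j i≢j)

  u-injective : ∀ {k} {i j : Fin k} → u i ≡ u j → i ≡ j
  u-injective {i = i} {j} ui≡uj with i ≟ᶠ j
  ... | yes i≡j = i≡j
  ... | no  i≢j with trans (sym (coord-u-same i)) (trans (cong (coord i) ui≡uj) (coord-u-diff j i (i≢j ∘ sym)))
  ...   | ()

  u-characterisation : ∀ {k} i (x : G k) → proj₂ x ≡ zero → coord i x ≡ suc zero →
                       (∀ j → i ≢ j → coord j x ≡ zero) → x ≡ u i
  u-characterisation i x x₇≡0 xᵢ≡1 xⱼ≡0 = coord-ext coords x₇≡0
    where
    coords : ∀ j → coord j x ≡ coord j (u i)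
    coords j with i ≟ᶠ j
    ... | yes refl = trans xᵢ≡1 (sym (coord-u-same i))
    ... | no  i≢j  = trans (xⱼ≡0 j i≢j) (sym (coord-u-diff i j i≢j))

  -- eₚ + e_q = eᵣ + eₛ with p ≠ r forces q = r (compare the r-th coordinates)
  u-sum-cancel : ∀ {k} (p q r s : Fin k) → u p ⊕ u q ≡ u r ⊕ u s → p ≢ r → q ≡ r
  u-sum-cancel p q r s sum≡ p≢r with q ≟ᶠ r
  ... | yes q≡r = q≡r
  ... | no  q≢r = ⊥-elim (r-th (coord-u-01 s r))
    where
    0≡1+uₛ : zero ≡ suc zero +₃ coord r (u s)
    0≡1+uₛ = begin
      zero                            ≡⟨⟩
      zero +₃ zero                    ≡⟨ sym (cong₂ _+₃_ (coord-u-diff p r p≢r) (coord-u-diff q r q≢r)) ⟩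
      coord r (u p) +₃ coord r (u q)  ≡⟨ sym (coord-⊕ r (u p) (u q)) ⟩
      coord r (u p ⊕ u q)             ≡⟨ cong (coord r) sum≡ ⟩
      coord r (u r ⊕ u s)             ≡⟨ coord-⊕ r (u r) (u s) ⟩
      coord r (u r) +₃ coord r (u s)  ≡⟨ cong (_+₃ coord r (u s)) (coord-u-same r) ⟩
      suc zero +₃ coord r (u s)       ∎
    r-th : coord r (u s) ≡ zero ⊎ coord r (u s) ≡ suc zero → ⊥
    r-th (inj₁ uₛ≡0) with trans 0≡1+uₛ (cong (suc zero +₃_) uₛ≡0)
    ... | ()
    r-th (inj₂ uₛ≡1) with trans 0≡1+uₛ (cong (suc zero +₃_) uₛ≡1)
    ... | ()

-- The base block D = {0, f₁, f₃} ∪ {u i}, indexed by the "role" of an element.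
data Role (k : ℕ) : Set where
  zeroᴰ oneᴰ threeᴰ : Role k
  unitᴰ : Fin k → Role k

module _ {k : ℕ} where

  open ≡-Reasoning

  D : Role k → G k
  D zeroᴰ     = 0G
  D oneᴰ      = f₁
  D threeᴰ    = f₃
  D (unitᴰ i) = u i

  D-injective : ∀ {r s : Role k} → D r ≡ D s → r ≡ s
  D-injective {zeroᴰ}   {zeroᴰ}   e = refl
  D-injective {oneᴰ}    {oneᴰ}    e = refl
  D-injective {threeᴰ}  {threeᴰ}  e = refl
  D-injective {unitᴰ i} {unitᴰ j} e = cong unitᴰ (u-injective e)
  D-injective {zeroᴰ}   {unitᴰ i} e with trans (sym (coord-0 i)) (trans (cong (coord i) e) (coord-u-same i))
  ... | ()
  D-injective {unitᴰ i} {zeroᴰ}   e with trans (sym (coord-0 i)) (trans (cong (coord i) (sym e)) (coord-u-same i))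
  ... | ()
  D-injective {zeroᴰ}   {oneᴰ}    ()
  D-injective {zeroᴰ}   {threeᴰ}  ()
  D-injective {oneᴰ}    {zeroᴰ}   ()
  D-injective {oneᴰ}    {threeᴰ}  ()
  D-injective {oneᴰ}    {unitᴰ i} ()
  D-injective {threeᴰ}  {zeroᴰ}   ()
  D-injective {threeᴰ}  {oneᴰ}    ()
  D-injective {threeᴰ}  {unitᴰ i} ()
  D-injective {unitᴰ i} {oneᴰ}    ()
  D-injective {unitᴰ i} {threeᴰ}  ()

  _≟ᴳ_ : (x y : G k) → Dec (x ≡ y)
  _≟ᴳ_ = ×-≡-dec (Vec-≡-dec _≟ᶠ_) _≟ᶠ_

  _≟ᴿ_ : (r s : Role k) → Dec (r ≡ s)
  r ≟ᴿ s = map′ D-injective (cong D) (D r ≟ᴳ D s)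

  InD⇒role : ∀ (x : G k) → InD x → ∃[ r ] x ≡ D r
  InD⇒role x (inj₁ (v≡0 , a≡0))                   = zeroᴰ   , cong₂ _,_ v≡0 a≡0
  InD⇒role x (inj₂ (inj₁ (i , v≡e , a≡0)))        = unitᴰ i , cong₂ _,_ v≡e a≡0
  InD⇒role x (inj₂ (inj₂ (v≡0 , inj₁ a≡0)))        = zeroᴰ   , cong₂ _,_ v≡0 a≡0
  InD⇒role x (inj₂ (inj₂ (v≡0 , inj₂ (inj₁ a≡1)))) = oneᴰ    , cong₂ _,_ v≡0 a≡1
  InD⇒role x (inj₂ (inj₂ (v≡0 , inj₂ (inj₂ a≡3)))) = threeᴰ  , cong₂ _,_ v≡0 a≡3

  D∈InD : ∀ r → InD (D r)
  D∈InD zeroᴰ     = inj₁ (refl , refl)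
  D∈InD oneᴰ      = inj₂ (inj₂ (refl , inj₂ (inj₁ refl)))
  D∈InD threeᴰ    = inj₂ (inj₂ (refl , inj₂ (inj₂ refl)))
  D∈InD (unitᴰ i) = inj₂ (inj₁ (i , refl , refl))

  incident⇒role : ∀ (p l : G k) → Incident p l → ∃[ r ] p ≡ l ⊕ D r
  incident⇒role p l p∈l with InD⇒role _ p∈l
  ... | r , p-l≡Dr = r , (begin
      p                ≡⟨ solve x₀ (x₁ ⊕' (x₀ ⊕' ⊖' x₁)) refl (p ∷ l ∷ []) ⟩
      l ⊕ (p ⊕ (⊖ l))  ≡⟨ cong (l ⊕_) p-l≡Dr ⟩
      l ⊕ D r          ∎)

  role⇒incident : ∀ (p l : G k) r → p ≡ l ⊕ D r → Incident p l
  role⇒incident p l r p≡l+Dr = subst InD (sym p-l≡Dr) (D∈InD r)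
    where
    p-l≡Dr : p ⊕ (⊖ l) ≡ D r
    p-l≡Dr = trans (cong (_⊕ (⊖ l)) p≡l+Dr) (solve ((x₀ ⊕' x₁) ⊕' ⊖' x₀) x₁ refl (l ∷ D r ∷ []))

  on-line : ∀ (l : G k) r → Incident (l ⊕ D r) l
  on-line l r = role⇒incident (l ⊕ D r) l r refl

  Collinear : G k → G k → Set
  Collinear p q = ∃[ l ] (Incident p l × Incident q l)

  collinear-via : ∀ (p q l : G k) r s → p ≡ l ⊕ D r → q ≡ l ⊕ D s → Collinear p q
  collinear-via p q l r s p≡ q≡ = l , role⇒incident p l r p≡ , role⇒incident q l s q≡

  ⊕-cancelˡ : ∀ (c x y : G k) → c ⊕ x ≡ c ⊕ y → x ≡ y
  ⊕-cancelˡ c x y c+x≡c+y = begin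
    x                 ≡⟨ solve x₁ ((x₀ ⊕' x₁) ⊕' ⊖' x₀) refl (c ∷ x ∷ []) ⟩
    (c ⊕ x) ⊕ (⊖ c)   ≡⟨ cong (_⊕ (⊖ c)) c+x≡c+y ⟩
    (c ⊕ y) ⊕ (⊖ c)   ≡⟨ solve ((x₀ ⊕' x₁) ⊕' ⊖' x₀) x₁ refl (c ∷ y ∷ []) ⟩
    y                 ∎

  ⊕-cancelʳ : ∀ (x y c : G k) → x ⊕ c ≡ y ⊕ c → x ≡ y
  ⊕-cancelʳ x y c x+c≡y+c = ⊕-cancelˡ c x y (trans (⊕-comm c x) (trans x+c≡y+c (⊕-comm y c)))

  ⊕D-injective : ∀ (b : G k) {r s} → b ⊕ D r ≡ b ⊕ D s → r ≡ s
  ⊕D-injective b e = D-injective (⊕-cancelˡ b _ _ e)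

module _ {k : ℕ} where

  open ≡-Reasoning

  coord-act : ∀ (σ : Permutation′ k) x j → coord j (act σ x) ≡ coord (σ ⟨$⟩ˡ j) x
  coord-act σ x j = lookup∘tabulate _ j

  act-⊕ : ∀ σ (x y : G k) → act σ (x ⊕ y) ≡ act σ x ⊕ act σ y
  act-⊕ σ x y = coord-ext (λ j → begin
      coord j (act σ (x ⊕ y))                      ≡⟨ coord-act σ (x ⊕ y) j ⟩
      coord (σ ⟨$⟩ˡ j) (x ⊕ y)                     ≡⟨ coord-⊕ (σ ⟨$⟩ˡ j) x y ⟩
      coord (σ ⟨$⟩ˡ j) x +₃ coord (σ ⟨$⟩ˡ j) y     ≡⟨ sym (cong₂ _+₃_ (coord-act σ x j) (coord-act σ y j)) ⟩
      coord j (act σ x) +₃ coord j (act σ y)       ≡⟨ sym (coord-⊕ j (act σ x) (act σ y)) ⟩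
      coord j (act σ x ⊕ act σ y)                  ∎)
    refl

  act-⊖ : ∀ σ (x : G k) → act σ (⊖ x) ≡ ⊖ act σ x
  act-⊖ σ x = coord-ext (λ j → begin
      coord j (act σ (⊖ x))      ≡⟨ coord-act σ (⊖ x) j ⟩
      coord (σ ⟨$⟩ˡ j) (⊖ x)     ≡⟨ lookup-map (σ ⟨$⟩ˡ j) -₃_ (proj₁ x) ⟩
      -₃ coord (σ ⟨$⟩ˡ j) x      ≡⟨ cong -₃_ (sym (coord-act σ x j)) ⟩
      -₃ coord j (act σ x)       ≡⟨ sym (lookup-map j -₃_ (proj₁ (act σ x))) ⟩
      coord j (⊖ act σ x)        ∎)
    refl

  act-C₇ : ∀ σ (a : Fin 7) → act σ (replicate k zero , a) ≡ (replicate k zero , a)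
  act-C₇ σ a = coord-ext (λ j → trans (coord-act σ (replicate k zero , a) j) (trans (coord-0 (σ ⟨$⟩ˡ j)) (sym (coord-0 j)))) refl

  act-u : ∀ σ i → act σ (u i) ≡ u (σ ⟨$⟩ʳ i)
  act-u σ i = u-characterisation (σ ⟨$⟩ʳ i) (act σ (u i)) refl
    (trans (coord-act σ (u i) _) (trans (cong (λ j → coord j (u i)) (inverseˡ σ)) (coord-u-same i)))
    (λ j σi≢j → trans (coord-act σ (u i) j)
                 (coord-u-diff i (σ ⟨$⟩ˡ j) (λ i≡σ⁻¹j → σi≢j (trans (cong (σ ⟨$⟩ʳ_) i≡σ⁻¹j) (inverseʳ σ)))))

  act-∘ : ∀ (σ τ : Permutation′ k) x → act (τ ∘ₚ σ) x ≡ act σ (act τ x)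
  act-∘ σ τ x = coord-ext (λ j → trans (coord-act (τ ∘ₚ σ) x j)
                                  (sym (trans (coord-act σ (act τ x) j) (coord-act τ x _)))) refl

  act-flip : ∀ (σ : Permutation′ k) x → act (flip σ) (act σ x) ≡ x
  act-flip σ x = coord-ext (λ j → trans (coord-act (flip σ) (act σ x) j)
                                   (trans (coord-act σ x _) (cong (λ i → coord i x) (inverseˡ σ)))) refl

  act-flip′ : ∀ (σ : Permutation′ k) x → act σ (act (flip σ) x) ≡ x
  act-flip′ σ x = coord-ext (λ j → trans (coord-act σ (act (flip σ) x) j)
                                    (trans (coord-act (flip σ) x _) (cong (λ i → coord i x) (inverseʳ σ)))) refl

  permuteRole : Permutation′ k → Role k → Role k
  permuteRole σ zeroᴰ     = zeroᴰ
  permuteRole σ oneᴰ      = oneᴰ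
  permuteRole σ threeᴰ    = threeᴰ
  permuteRole σ (unitᴰ i) = unitᴰ (σ ⟨$⟩ʳ i)

  act-D : ∀ σ r → act σ (D r) ≡ D (permuteRole σ r)
  act-D σ zeroᴰ     = act-C₇ σ zero
  act-D σ oneᴰ      = act-C₇ σ _
  act-D σ threeᴰ    = act-C₇ σ _
  act-D σ (unitᴰ i) = act-u σ i

  InD-act : ∀ σ (x : G k) → InD x → InD (act σ x)
  InD-act σ x x∈D with InD⇒role x x∈D
  ... | r , x≡Dr = subst InD (sym (trans (cong (act σ) x≡Dr) (act-D σ r))) (D∈InD (permuteRole σ r))

  -- Φ(σ, t) preserves differences up to σ, hence incidence in both directions
  Φ-difference : ∀ σ t (p l : G k) → (act σ p ⊕ t) ⊕ (⊖ (act σ l ⊕ t)) ≡ act σ (p ⊕ (⊖ l))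
  Φ-difference σ t p l = begin
    (act σ p ⊕ t) ⊕ (⊖ (act σ l ⊕ t))  ≡⟨ solve ((x₀ ⊕' x₂) ⊕' ⊖' (x₁ ⊕' x₂)) (x₀ ⊕' ⊖' x₁) refl (act σ p ∷ act σ l ∷ t ∷ []) ⟩
    act σ p ⊕ (⊖ act σ l)              ≡⟨ cong (act σ p ⊕_) (sym (act-⊖ σ l)) ⟩
    act σ p ⊕ act σ (⊖ l)              ≡⟨ sym (act-⊕ σ p (⊖ l)) ⟩
    act σ (p ⊕ (⊖ l))                  ∎

  Φ-bijective : ∀ (s : SD k) → Bijective _≡_ _≡_ (Φpt s)
  Φ-bijective (σ , t) = injective , surjective
    where
    injective : ∀ {x y} → act σ x ⊕ t ≡ act σ y ⊕ t → x ≡ y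
    injective {x} {y} e = begin
      x                       ≡⟨ sym (act-flip σ x) ⟩
      act (flip σ) (act σ x)  ≡⟨ cong (act (flip σ)) (⊕-cancelʳ _ _ t e) ⟩
      act (flip σ) (act σ y)  ≡⟨ act-flip σ y ⟩
      y                       ∎
    surjective : ∀ y → ∃[ x ] (∀ {z} → z ≡ x → act σ z ⊕ t ≡ y)
    surjective y = act (flip σ) (y ⊕ (⊖ t)) , λ { refl → begin
      act σ (act (flip σ) (y ⊕ (⊖ t))) ⊕ t  ≡⟨ cong (_⊕ t) (act-flip′ σ (y ⊕ (⊖ t))) ⟩
      (y ⊕ (⊖ t)) ⊕ t                       ≡⟨ solve ((x₀ ⊕' ⊖' x₁) ⊕' x₁) x₀ refl (y ∷ t ∷ []) ⟩
      y                                     ∎ }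

  Φ-automorphism : ∀ (s : SD k) → IsAut (Φpt s) (Φln s)
  Φ-automorphism (σ , t) = Φ-bijective (σ , t) , Φ-bijective (σ , t) , λ p l → mk⇔
    (λ p∈l → subst InD (sym (Φ-difference σ t p l)) (InD-act σ _ p∈l))
    (λ Φp∈Φl → subst InD (act-flip σ _) (InD-act (flip σ) _ (subst InD (Φ-difference σ t p l) Φp∈Φl)))

  -- Φ is injective: the translation is Φ(0), the permutation is read off Φ(u i)
  Φ-injective : ∀ (s s′ : SD k) → (∀ p → Φpt s p ≡ Φpt s′ p) → s ≈SD s′
  Φ-injective (σ , t) (σ′ , t′) same = σ≗σ′ , t≡t′
    where
    Φ0 : ∀ σ t → act σ 0G ⊕ t ≡ t
    Φ0 σ t = trans (cong (_⊕ t) (act-C₇ σ zero)) (solve (∅ ⊕' x₀) x₀ refl (t ∷ []))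
    t≡t′ : t ≡ t′
    t≡t′ = trans (sym (Φ0 σ t)) (trans (same 0G) (Φ0 σ′ t′))
    σ≗σ′ : ∀ i → σ ⟨$⟩ʳ i ≡ σ′ ⟨$⟩ʳ i
    σ≗σ′ i = u-injective (⊕-cancelʳ _ _ t (begin
      u (σ ⟨$⟩ʳ i) ⊕ t    ≡⟨ cong (_⊕ t) (sym (act-u σ i)) ⟩
      act σ (u i) ⊕ t     ≡⟨ same (u i) ⟩
      act σ′ (u i) ⊕ t′   ≡⟨ cong₂ _⊕_ (act-u σ′ i) (sym t≡t′) ⟩
      u (σ′ ⟨$⟩ʳ i) ⊕ t   ∎))

  Φ-homomorphism : ∀ (s s′ : SD k) p → Φpt (s ·SD s′) p ≡ Φpt s (Φpt s′ p)
  Φ-homomorphism (σ , t) (τ , t′) p = begin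
    act (τ ∘ₚ σ) p ⊕ (t ⊕ act σ t′)        ≡⟨ cong (_⊕ (t ⊕ act σ t′)) (act-∘ σ τ p) ⟩
    act σ (act τ p) ⊕ (t ⊕ act σ t′)       ≡⟨ solve (x₀ ⊕' (x₁ ⊕' x₂)) ((x₀ ⊕' x₂) ⊕' x₁) refl (act σ (act τ p) ∷ t ∷ act σ t′ ∷ []) ⟩
    (act σ (act τ p) ⊕ act σ t′) ⊕ t       ≡⟨ cong (_⊕ t) (sym (act-⊕ σ (act τ p) t′)) ⟩
    act σ (act τ p ⊕ t′) ⊕ t               ∎

-- Local geometry of 𝔐, part 1: the point b + f₁ of the line b is the only one
-- collinear with the witness w(b, i) = b + 2f₁ - eᵢ.  This is proved on the
-- "profile" (i-th C₃-coordinate, C₇-coordinate) of the elements of D.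
_+ᵖ_ : Fin 3 × Fin 7 → Fin 3 × Fin 7 → Fin 3 × Fin 7
(a , b) +ᵖ (c , d) = a +₃ c , b +₇ d

profileOf : Fin 4 → Fin 3 × Fin 7
profileOf zero                   = zero , zero
profileOf (suc zero)             = suc zero , zero
profileOf (suc (suc zero))       = zero , suc zero
profileOf (suc (suc (suc zero))) = zero , suc (suc (suc zero))

profile-equation : ∀ a b c → profileOf a +ᵖ profileOf b ≡ (suc (suc zero) , suc (suc zero)) +ᵖ profileOf c →
                   a ≡ suc (suc zero)
profile-equation = from-yes (all? λ a → all? λ b → all? λ c →
  ×-≡-dec _≟ᶠ_ _≟ᶠ_ (profileOf a +ᵖ profileOf b) ((suc (suc zero) , suc (suc zero)) +ᵖ profileOf c)
    →-dec (a ≟ᶠ suc (suc zero)))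

module _ {k : ℕ} where

  open ≡-Reasoning

  profile : Fin k → G k → Fin 3 × Fin 7
  profile i x = coord i x , proj₂ x

  profile-⊕ : ∀ i (x y : G k) → profile i (x ⊕ y) ≡ profile i x +ᵖ profile i y
  profile-⊕ i x y = cong (_, _) (coord-⊕ i x y)

  profileIndex : Fin k → Role k → Fin 4
  profileIndex i zeroᴰ     = zero
  profileIndex i oneᴰ      = suc (suc zero)
  profileIndex i threeᴰ    = suc (suc (suc zero))
  profileIndex i (unitᴰ m) with m ≟ᶠ i
  ... | yes _ = suc zero
  ... | no  _ = zero

  profile-D : ∀ i r → profile i (D r) ≡ profileOf (profileIndex i r)
  profile-D i zeroᴰ     = cong (_, _) (coord-0 i)
  profile-D i oneᴰ      = cong (_, _) (coord-0 i)
  profile-D i threeᴰ    = cong (_, _) (coord-0 i)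
  profile-D i (unitᴰ m) with m ≟ᶠ i
  ... | yes refl = cong (_, _) (coord-u-same i)
  ... | no  m≢i  = cong (_, _) (coord-u-diff m i m≢i)

  profileIndex-f₁ : ∀ i r → profileIndex i r ≡ suc (suc zero) → r ≡ oneᴰ
  profileIndex-f₁ i oneᴰ e = refl
  profileIndex-f₁ i (unitᴰ m) e with m ≟ᶠ i
  profileIndex-f₁ i (unitᴰ m) () | yes _
  profileIndex-f₁ i (unitᴰ m) () | no  _

  profile-2f₁-eᵢ : ∀ i → profile i ((f₁ ⊕ f₁) ⊕ (⊖ u i)) ≡ (suc (suc zero) , suc (suc zero))
  profile-2f₁-eᵢ i = cong (_, _) (begin
    coord i ((f₁ ⊕ f₁) ⊕ (⊖ u i))                         ≡⟨ coord-⊕ i (f₁ ⊕ f₁) (⊖ u i) ⟩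
    coord i (f₁ ⊕ f₁) +₃ coord i (⊖ u i)                  ≡⟨ cong₂ _+₃_ (coord-⊕ i f₁ f₁) (lookup-map i -₃_ (unit i)) ⟩
    (coord i f₁ +₃ coord i f₁) +₃ (-₃ coord i (u i))      ≡⟨ cong₂ (λ a b → (a +₃ a) +₃ (-₃ b)) (coord-0 i) (coord-u-same i) ⟩
    suc (suc zero)                                        ∎)

  f₁-forced : ∀ i (d s t : Role k) → D d ⊕ D s ≡ ((f₁ ⊕ f₁) ⊕ (⊖ u i)) ⊕ D t → d ≡ oneᴰ
  f₁-forced i d s t eq = profileIndex-f₁ i d (profile-equation (profileIndex i d) (profileIndex i s) (profileIndex i t) (begin
    profileOf (profileIndex i d) +ᵖ profileOf (profileIndex i s)  ≡⟨ sym (cong₂ _+ᵖ_ (profile-D i d) (profile-D i s)) ⟩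
    profile i (D d) +ᵖ profile i (D s)                            ≡⟨ sym (profile-⊕ i (D d) (D s)) ⟩
    profile i (D d ⊕ D s)                                         ≡⟨ cong (profile i) eq ⟩
    profile i (((f₁ ⊕ f₁) ⊕ (⊖ u i)) ⊕ D t)                       ≡⟨ profile-⊕ i ((f₁ ⊕ f₁) ⊕ (⊖ u i)) (D t) ⟩
    profile i ((f₁ ⊕ f₁) ⊕ (⊖ u i)) +ᵖ profile i (D t)            ≡⟨ cong₂ _+ᵖ_ (profile-2f₁-eᵢ i) (profile-D i t) ⟩
    (suc (suc zero) , suc (suc zero)) +ᵖ profileOf (profileIndex i t) ∎))

  witness : G k → Fin k → G k
  witness b i = ((b ⊕ f₁) ⊕ f₁) ⊕ (⊖ u i)

  -- w(b, i) = (b + f₁ - eᵢ) + f₁ and b + f₁ = (b + f₁ - eᵢ) + eᵢ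
  witness-collinear : ∀ b i → Collinear (witness b i) (b ⊕ f₁)
  witness-collinear b i = collinear-via (witness b i) (b ⊕ f₁) ((b ⊕ f₁) ⊕ (⊖ u i)) oneᴰ (unitᴰ i)
    (solveᵗ (21 ∷ 3 ∷ []) (((x₀ ⊕' F₁) ⊕' F₁) ⊕' ⊖' x₁) (((x₀ ⊕' F₁) ⊕' ⊖' x₁) ⊕' F₁) refl (b ∷ u i ∷ []) (exponent-21 b ∷ u-order i ∷ []))
    (solveᵗ (21 ∷ 3 ∷ []) (x₀ ⊕' F₁) (((x₀ ⊕' F₁) ⊕' ⊖' x₁) ⊕' x₁) refl (b ∷ u i ∷ []) (exponent-21 b ∷ u-order i ∷ []))

  witness-equation : ∀ b e i (d s t : Role k) → b ⊕ D d ≡ e ⊕ D t → witness b i ≡ e ⊕ D s →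
                     D d ⊕ D s ≡ ((f₁ ⊕ f₁) ⊕ (⊖ u i)) ⊕ D t
  witness-equation b e i d s t same-x w≡e+Ds = begin
      D d ⊕ D s                                   ≡⟨ solve (x₂ ⊕' x₃) ((x₀ ⊕' x₂) ⊕' ((x₁ ⊕' x₃) ⊕' (⊖' x₀ ⊕' ⊖' x₁))) refl (b ∷ e ∷ D d ∷ D s ∷ []) ⟩
      (b ⊕ D d) ⊕ ((e ⊕ D s) ⊕ ((⊖ b) ⊕ (⊖ e)))   ≡⟨ cong₂ (λ p q → p ⊕ (q ⊕ ((⊖ b) ⊕ (⊖ e)))) same-x (sym w≡e+Ds) ⟩
      (e ⊕ D t) ⊕ (witness b i ⊕ ((⊖ b) ⊕ (⊖ e))) ≡⟨ solveᵗ (21 ∷ 21 ∷ 21 ∷ 3 ∷ [])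
                                                       ((x₁ ⊕' x₂) ⊕' ((((x₀ ⊕' F₁) ⊕' F₁) ⊕' ⊖' x₃) ⊕' (⊖' x₀ ⊕' ⊖' x₁)))
                                                       (((F₁ ⊕' F₁) ⊕' ⊖' x₃) ⊕' x₂) refl (b ∷ e ∷ D t ∷ u i ∷ [])
                                                       (exponent-21 b ∷ exponent-21 e ∷ exponent-21 (D t) ∷ u-order i ∷ []) ⟩
      ((f₁ ⊕ f₁) ⊕ (⊖ u i)) ⊕ D t                 ∎

  sees-witness⇒f₁ : ∀ b i x → Incident x b → Collinear (witness b i) x → x ≡ b ⊕ f₁
  sees-witness⇒f₁ b i x x∈b (e , w∈e , x∈e) =
    conclude (incident⇒role x b x∈b) (incident⇒role _ e w∈e) (incident⇒role x e x∈e)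
    where
    conclude : ∃[ d ] x ≡ b ⊕ D d → ∃[ s ] witness b i ≡ e ⊕ D s → ∃[ t ] x ≡ e ⊕ D t → x ≡ b ⊕ f₁
    conclude (d , x≡b+Dd) (s , w≡e+Ds) (t , x≡e+Dt) =
      trans x≡b+Dd (cong (λ r → b ⊕ D r)
        (f₁-forced i d s t (witness-equation b e i d s t (trans (sym x≡b+Dd) x≡e+Dt) w≡e+Ds)))

-- Local geometry of 𝔐, part 2: every other point c + D r (r ≠ f₁) of a line c
-- shares each of its collinear points Q with a second point of c.  The reason
-- is that Q - c = D r - D t + D s can be rewritten with a first role r′ ≠ r.
module _ {k : ℕ} where

  open ≡-Reasoning

  Reexpressed : Role k → G k → Set
  Reexpressed r Δ = ∃[ r′ ] ∃[ t′ ] ∃[ s′ ] (r′ ≢ r × Δ ≡ (D r′ ⊕ (⊖ D t′)) ⊕ D s′)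

  reexpress-double : ∀ r t → r ≢ oneᴰ → Reexpressed r ((D r ⊕ (⊖ D t)) ⊕ D r)
  reexpress-double oneᴰ      t         r≢1 = ⊥-elim (r≢1 refl)
  reexpress-double zeroᴰ     zeroᴰ     _ = threeᴰ , threeᴰ , zeroᴰ , (λ ()) ,
    solve {n = 0} ((∅ ⊕' ⊖' ∅) ⊕' ∅) ((F₃ ⊕' ⊖' F₃) ⊕' ∅) refl []
  reexpress-double zeroᴰ     oneᴰ      _ = threeᴰ , zeroᴰ , threeᴰ , (λ ()) ,
    solve {n = 0} ((∅ ⊕' ⊖' F₁) ⊕' ∅) ((F₃ ⊕' ⊖' ∅) ⊕' F₃) refl []
  reexpress-double zeroᴰ     threeᴰ    _ = oneᴰ , zeroᴰ , threeᴰ , (λ ()) ,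
    solve {n = 0} ((∅ ⊕' ⊖' F₃) ⊕' ∅) ((F₁ ⊕' ⊖' ∅) ⊕' F₃) refl []
  reexpress-double zeroᴰ     (unitᴰ i) _ = unitᴰ i , zeroᴰ , unitᴰ i , (λ ()) ,
    solveᵗ (3 ∷ []) ((∅ ⊕' ⊖' x₀) ⊕' ∅) ((x₀ ⊕' ⊖' ∅) ⊕' x₀) refl (u i ∷ []) (u-order i ∷ [])
  reexpress-double threeᴰ    zeroᴰ     _ = zeroᴰ , oneᴰ , zeroᴰ , (λ ()) ,
    solve {n = 0} ((F₃ ⊕' ⊖' ∅) ⊕' F₃) ((∅ ⊕' ⊖' F₁) ⊕' ∅) refl []
  reexpress-double threeᴰ    oneᴰ      _ = zeroᴰ , threeᴰ , oneᴰ , (λ ()) ,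
    solve {n = 0} ((F₃ ⊕' ⊖' F₁) ⊕' F₃) ((∅ ⊕' ⊖' F₃) ⊕' F₁) refl []
  reexpress-double threeᴰ    threeᴰ    _ = zeroᴰ , zeroᴰ , threeᴰ , (λ ()) ,
    solve {n = 0} ((F₃ ⊕' ⊖' F₃) ⊕' F₃) ((∅ ⊕' ⊖' ∅) ⊕' F₃) refl []
  reexpress-double threeᴰ    (unitᴰ i) _ = unitᴰ i , oneᴰ , unitᴰ i , (λ ()) ,
    solveᵗ (3 ∷ []) ((F₃ ⊕' ⊖' x₀) ⊕' F₃) ((x₀ ⊕' ⊖' F₁) ⊕' x₀) refl (u i ∷ []) (u-order i ∷ [])
  reexpress-double (unitᴰ i) zeroᴰ     _ = zeroᴰ , unitᴰ i , zeroᴰ , (λ ()) ,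
    solveᵗ (3 ∷ []) ((x₀ ⊕' ⊖' ∅) ⊕' x₀) ((∅ ⊕' ⊖' x₀) ⊕' ∅) refl (u i ∷ []) (u-order i ∷ [])
  reexpress-double (unitᴰ i) oneᴰ      _ = threeᴰ , unitᴰ i , threeᴰ , (λ ()) ,
    solveᵗ (3 ∷ []) ((x₀ ⊕' ⊖' F₁) ⊕' x₀) ((F₃ ⊕' ⊖' x₀) ⊕' F₃) refl (u i ∷ []) (u-order i ∷ [])
  reexpress-double (unitᴰ i) threeᴰ    _ = oneᴰ , unitᴰ i , threeᴰ , (λ ()) ,
    solveᵗ (3 ∷ []) ((x₀ ⊕' ⊖' F₃) ⊕' x₀) ((F₁ ⊕' ⊖' x₀) ⊕' F₃) refl (u i ∷ []) (u-order i ∷ [])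
  reexpress-double (unitᴰ i) (unitᴰ j) _ with i ≟ᶠ j
  ... | yes refl = zeroᴰ , zeroᴰ , unitᴰ i , (λ ()) ,
    solveᵗ (3 ∷ []) ((x₀ ⊕' ⊖' x₀) ⊕' x₀) ((∅ ⊕' ⊖' ∅) ⊕' x₀) refl (u i ∷ []) (u-order i ∷ [])
  ... | no  i≢j  = unitᴰ j , unitᴰ i , unitᴰ j , (λ { refl → i≢j refl }) ,
    solveᵗ (3 ∷ 3 ∷ []) ((x₀ ⊕' ⊖' x₁) ⊕' x₀) ((x₁ ⊕' ⊖' x₀) ⊕' x₁) refl (u i ∷ u j ∷ []) (u-order i ∷ u-order j ∷ [])

  reexpress : ∀ r t s → r ≢ oneᴰ → Reexpressed r ((D r ⊕ (⊖ D t)) ⊕ D s)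
  reexpress r t s r≢1 with s ≟ᴿ r
  ... | yes refl = reexpress-double r t r≢1
  ... | no  s≢r  = s , t , r , s≢r , solve ((x₀ ⊕' ⊖' x₁) ⊕' x₂) ((x₂ ⊕' ⊖' x₁) ⊕' x₀) refl (D r ∷ D t ∷ D s ∷ [])

  -- if Q - c = D r′ - D t′ + D s′, then Q and c + D r′ lie on the line c + D r′ - D t′
  reexpressed⇒second-point : ∀ c Q r Δ → Reexpressed r Δ → Q ≡ c ⊕ Δ →
                             ∃[ x ] (Incident x c × Collinear Q x × x ≢ c ⊕ D r)
  reexpressed⇒second-point c Q r Δ (r′ , t′ , s′ , r′≢r , Δ≡) Q≡c+Δ =
    c ⊕ D r′ , on-line c r′ , collinear-via Q (c ⊕ D r′) ℓ s′ t′ Q≡ℓ+Ds′ c+Dr′≡ℓ+Dt′ , r′≢r ∘ ⊕D-injective c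
    where
    ℓ : G k
    ℓ = (c ⊕ D r′) ⊕ (⊖ D t′)
    Q≡ℓ+Ds′ : Q ≡ ℓ ⊕ D s′
    Q≡ℓ+Ds′ = trans Q≡c+Δ (trans (cong (c ⊕_) Δ≡)
      (solve (x₀ ⊕' ((x₁ ⊕' ⊖' x₂) ⊕' x₃)) (((x₀ ⊕' x₁) ⊕' ⊖' x₂) ⊕' x₃) refl (c ∷ D r′ ∷ D t′ ∷ D s′ ∷ [])))
    c+Dr′≡ℓ+Dt′ : c ⊕ D r′ ≡ ℓ ⊕ D t′
    c+Dr′≡ℓ+Dt′ = solve (x₀ ⊕' x₁) (((x₀ ⊕' x₁) ⊕' ⊖' x₂) ⊕' x₂) refl (c ∷ D r′ ∷ D t′ ∷ [])

  second-point : ∀ c Q r → r ≢ oneᴰ → Collinear Q (c ⊕ D r) →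
                 ∃[ x ] (Incident x c × Collinear Q x × x ≢ c ⊕ D r)
  second-point c Q r r≢1 (e , Q∈e , p∈e) = conclude (incident⇒role Q e Q∈e) (incident⇒role _ e p∈e)
    where
    conclude : ∃[ s ] Q ≡ e ⊕ D s → ∃[ t ] c ⊕ D r ≡ e ⊕ D t →
               ∃[ x ] (Incident x c × Collinear Q x × x ≢ c ⊕ D r)
    conclude (s , Q≡e+Ds) (t , p≡e+Dt) =
      reexpressed⇒second-point c Q r _ (reexpress r t s r≢1) (begin
        Q                                 ≡⟨ Q≡e+Ds ⟩
        e ⊕ D s                           ≡⟨ solve (x₀ ⊕' x₂) (((x₀ ⊕' x₁) ⊕' ⊖' x₁) ⊕' x₂) refl (e ∷ D t ∷ D s ∷ []) ⟩
        ((e ⊕ D t) ⊕ (⊖ D t)) ⊕ D s       ≡⟨ cong (λ p → (p ⊕ (⊖ D t)) ⊕ D s) (sym p≡e+Dt) ⟩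
        ((c ⊕ D r) ⊕ (⊖ D t)) ⊕ D s       ≡⟨ solve (((x₀ ⊕' x₁) ⊕' ⊖' x₂) ⊕' x₃) (x₀ ⊕' ((x₁ ⊕' ⊖' x₂) ⊕' x₃)) refl (c ∷ D r ∷ D t ∷ D s ∷ []) ⟩
        c ⊕ ((D r ⊕ (⊖ D t)) ⊕ D s)       ∎)

  Isolated : G k → G k → Set
  Isolated c p = Incident p c × ∃[ Q ] (Collinear Q p × (∀ x → Incident x c → Collinear Q x → x ≡ p))

  -- the isolated points of a line b are exactly b + f₁ (the witness needs some index i, so k ≥ 1)
  f₁-isolated : Fin k → ∀ b → Isolated b (b ⊕ f₁)
  f₁-isolated i b = on-line b oneᴰ , witness b i , witness-collinear b i , sees-witness⇒f₁ b i

  isolated⇒f₁ : ∀ c p → Isolated c p → p ≡ c ⊕ f₁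
  isolated⇒f₁ c p (p∈c , Q , Q~p , unique) = conclude (incident⇒role p c p∈c)
    where
    refute : ∀ {r} → p ≡ c ⊕ D r → ∃[ x ] (Incident x c × Collinear Q x × x ≢ c ⊕ D r) → ⊥
    refute p≡c+Dr (x , x∈c , Q~x , x≢c+Dr) = x≢c+Dr (trans (unique x x∈c Q~x) p≡c+Dr)
    conclude : ∃[ r ] p ≡ c ⊕ D r → p ≡ c ⊕ f₁
    conclude (r , p≡c+Dr) with r ≟ᴿ oneᴰ
    ... | yes refl = p≡c+Dr
    ... | no  r≢1  = ⊥-elim (refute {r} p≡c+Dr (second-point c Q r r≢1 (subst (Collinear Q) p≡c+Dr Q~p)))

weight : ∀ {n} → Vec (Fin 3) n → ℕ
weight []      = 0
weight (c ∷ v) = toℕ c + weight v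

zipWith-zeroʳ : ∀ {n} (v : Vec (Fin 3) n) {z : Vec (Fin 3) n} → (∀ j → lookup z j ≡ zero) → zipWith _+₃_ v z ≡ v
zipWith-zeroʳ v z≡0 = vec-ext λ j → trans (lookup-zipWith _+₃_ j v _) (trans (cong (lookup v j +₃_) (z≡0 j)) (+₃-idʳ (lookup v j)))

peel : ∀ {n} (v : Vec (Fin 3) n) → v ≡ replicate n zero ⊎ ∃[ j ] ∃[ w ] (v ≡ zipWith _+₃_ w (unit j) × weight w < weight v)
peel []      = inj₁ refl
peel (zero ∷ v) with peel v
... | inj₁ v≡0                 = inj₁ (cong (zero ∷_) v≡0)
... | inj₂ (j , w , v≡w+e , lighter) = inj₂ (suc j , zero ∷ w , cong (zero ∷_) v≡w+e , lighter)
peel (suc zero ∷ v)       = inj₂ (zero , zero ∷ v , cong (suc zero ∷_) (sym (zipWith-zeroʳ v (lookup∘tabulate _))) , ≤-refl)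
peel (suc (suc zero) ∷ v) = inj₂ (zero , suc zero ∷ v , cong (suc (suc zero) ∷_) (sym (zipWith-zeroʳ v (lookup∘tabulate _))) , ≤-refl)

C₇-generated : ∀ a → C₇.times (toℕ a) (suc zero) ≡ a
C₇-generated = from-yes (all? λ a → C₇.times (toℕ a) (suc zero) ≟ᶠ a)

module _ {k : ℕ} (P : G k → Set) (P0 : P 0G)
         (P+f₁ : ∀ x → P x → P (x ⊕ f₁)) (P+u : ∀ x j → P x → P (x ⊕ u j)) where

  private
    vectors : ∀ n (v : Vec (Fin 3) k) → weight v ≤ n → P (v , zero)
    vectors n v weight≤n with peel v
    vectors n       v weight≤n | inj₁ v≡0 = subst P (cong (_, zero) (sym v≡0)) P0
    vectors zero    v weight≤n | inj₂ (j , w , v≡w+e , lighter) = ⊥-elim (n≮0 (≤-trans lighter weight≤n))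
    vectors (suc n) v weight≤n | inj₂ (j , w , v≡w+e , lighter) =
      subst P (cong (_, zero) (sym v≡w+e)) (P+u (w , zero) j (vectors n w (≤-pred (≤-trans lighter weight≤n))))

    multiples : ∀ v n → P (v , zero) → P (v , C₇.times n (suc zero))
    multiples v zero    P[v,0] = P[v,0]
    multiples v (suc n) P[v,0] = subst P (cong₂ _,_ (zipWith-zeroʳ v (λ j → lookup-replicate j zero))
                                              (+₇-comm (C₇.times n (suc zero)) (suc zero)))
                                       (P+f₁ _ (multiples v n P[v,0]))

  generated : ∀ x → P x
  generated (v , a) = subst (λ b → P (v , b)) (C₇-generated a) (multiples v (toℕ a) (vectors (weight v) v ≤-refl))

⊕-fixed : ∀ {k} (x c : G k) → x ⊕ c ≡ x → c ≡ 0G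
⊕-fixed x c x+c≡x = ⊕-cancelˡ x c 0G (trans x+c≡x (sym (⊕-idʳ x)))

-- the roles 0 and f₃, which f can a priori interchange on a line
data ZeroOrThree {k : ℕ} : Role k → Set where
  isZero  : ZeroOrThree zeroᴰ
  isThree : ZeroOrThree threeᴰ

-- Every automorphism (f, g) of 𝔐 equals Φ(σ, f 0) for some σ ∈ Sₖ; i₀ witnesses k ≥ 1.
module Automorphism {k : ℕ} (i₀ : Fin k) (f g : G k → G k) (aut : IsAut f g) where

  open ≡-Reasoning

  f-injective : ∀ {x y} → f x ≡ f y → x ≡ y
  f-injective = proj₁ (proj₁ aut)

  g-injective : ∀ {x y} → g x ≡ g y → x ≡ y
  g-injective = proj₁ (proj₁ (proj₂ aut))

  f-preimage : ∀ y → ∃[ x ] f x ≡ y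
  f-preimage y = proj₁ (proj₂ (proj₁ aut) y) , proj₂ (proj₂ (proj₁ aut) y) refl

  g-preimage : ∀ l → ∃[ m ] g m ≡ l
  g-preimage l = proj₁ (proj₂ (proj₁ (proj₂ aut)) l) , proj₂ (proj₂ (proj₁ (proj₂ aut)) l) refl

  preserves : ∀ p l → Incident p l → Incident (f p) (g l)
  preserves p l = Equivalence.to (proj₂ (proj₂ aut) p l)

  reflects : ∀ p l → Incident (f p) (g l) → Incident p l
  reflects p l = Equivalence.from (proj₂ (proj₂ aut) p l)

  collinear-preserved : ∀ {p q} → Collinear p q → Collinear (f p) (f q)
  collinear-preserved {p} {q} (l , p∈l , q∈l) = g l , preserves p l p∈l , preserves q l q∈l

  collinear-reflected : ∀ {p q} → Collinear (f p) (f q) → Collinear p q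
  collinear-reflected {p} {q} (l , fp∈l , fq∈l) with g-preimage l
  ... | m , refl = m , reflects p m fp∈l , reflects q m fq∈l

  isolated-preserved : ∀ {c p} → Isolated c p → Isolated (g c) (f p)
  isolated-preserved {c} {p} (p∈c , Q , Q~p , unique) = preserves p c p∈c , f Q , collinear-preserved Q~p , unique′
    where
    unique′ : ∀ x → Incident x (g c) → Collinear (f Q) x → x ≡ f p
    unique′ x with f-preimage x
    ... | y , refl = λ fy∈gc fQ~fy → cong f (unique y (reflects y c fy∈gc) (collinear-reflected fQ~fy))

  image-on-line : ∀ b r → ∃[ r′ ] f (b ⊕ D r) ≡ g b ⊕ D r′
  image-on-line b r = incident⇒role (f (b ⊕ D r)) (g b) (preserves (b ⊕ D r) b (on-line b r))

  -- Step 1: f (b + f₁) = g b + f₁, as b + f₁ is the isolated point of the line b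
  f-shift-f₁ : ∀ b → f (b ⊕ f₁) ≡ g b ⊕ f₁
  f-shift-f₁ b = isolated⇒f₁ (g b) (f (b ⊕ f₁)) (isolated-preserved (f₁-isolated i₀ b))

  -- Step 2: f maps b + 0 and b + f₃ to no point g b + eⱼ.  Otherwise, for
  -- p = b + D r and y = p - f₁, the point f (b + f₁) is the witness w(g y, j)
  -- and is collinear with f y, so Step 1 on the line g y would give y = p.
  shifted-collinear : ∀ (b : G k) {r} → ZeroOrThree r → Collinear (b ⊕ f₁) ((b ⊕ D r) ⊕ (⊖ f₁))
  shifted-collinear b isZero  = collinear-via (b ⊕ f₁) ((b ⊕ 0G) ⊕ (⊖ f₁)) ((b ⊕ f₁) ⊕ (⊖ f₃)) threeᴰ oneᴰ
    (solve (x₀ ⊕' F₁) (((x₀ ⊕' F₁) ⊕' ⊖' F₃) ⊕' F₃) refl (b ∷ []))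
    (solve ((x₀ ⊕' ∅) ⊕' ⊖' F₁) (((x₀ ⊕' F₁) ⊕' ⊖' F₃) ⊕' F₁) refl (b ∷ []))
  shifted-collinear b isThree = collinear-via (b ⊕ f₁) ((b ⊕ f₃) ⊕ (⊖ f₁)) (b ⊕ f₁) zeroᴰ oneᴰ
    (solve (x₀ ⊕' F₁) ((x₀ ⊕' F₁) ⊕' ∅) refl (b ∷ []))
    (solve ((x₀ ⊕' F₃) ⊕' ⊖' F₁) ((x₀ ⊕' F₁) ⊕' F₁) refl (b ∷ []))

  not-to-unit : ∀ b {r} → ZeroOrThree r → ∀ j → f (b ⊕ D r) ≢ g b ⊕ u j
  not-to-unit b {r} zt j fp≡gb+uⱼ = -f₁≢0 (⊕-fixed p (⊖ f₁) (f-injective (trans fy≡gy+f₁ (sym fp≡gy+f₁))))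
    where
    p y : G k
    p = b ⊕ D r
    y = p ⊕ (⊖ f₁)
    -f₁≢0 : ⊖ f₁ ≢ 0G {k}
    -f₁≢0 ()
    fp≡gy+f₁ : f p ≡ g y ⊕ f₁
    fp≡gy+f₁ = trans (cong f (solve x₀ ((x₀ ⊕' ⊖' F₁) ⊕' F₁) refl (p ∷ []))) (f-shift-f₁ y)
    witness≡ : witness (g y) j ≡ f (b ⊕ f₁)
    witness≡ = begin
      ((g y ⊕ f₁) ⊕ f₁) ⊕ (⊖ u j)    ≡⟨ cong (λ q → (q ⊕ f₁) ⊕ (⊖ u j)) (trans (sym fp≡gy+f₁) fp≡gb+uⱼ) ⟩
      ((g b ⊕ u j) ⊕ f₁) ⊕ (⊖ u j)   ≡⟨ solve (((x₀ ⊕' x₁) ⊕' F₁) ⊕' ⊖' x₁) (x₀ ⊕' F₁) refl (g b ∷ u j ∷ []) ⟩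
      g b ⊕ f₁                       ≡⟨ sym (f-shift-f₁ b) ⟩
      f (b ⊕ f₁)                     ∎
    fy≡gy+f₁ : f y ≡ g y ⊕ f₁
    fy≡gy+f₁ = sees-witness⇒f₁ (g y) j (f y)
      (preserves y y (subst (λ q → Incident q y) (⊕-idʳ y) (on-line y zeroᴰ)))
      (subst (λ w → Collinear w (f y)) (sym witness≡) (collinear-preserved {b ⊕ f₁} {y} (shifted-collinear b zt)))

  zero-or-three-image : ∀ b {r} → ZeroOrThree r → ∃[ r′ ] (ZeroOrThree r′ × f (b ⊕ D r) ≡ g b ⊕ D r′)
  zero-or-three-image b {r} zt = classify (image-on-line b r)
    where
    not-one : ∀ {r} → ZeroOrThree r → r ≢ oneᴰ
    not-one isZero  ()
    not-one isThree ()
    classify : ∃[ r′ ] f (b ⊕ D r) ≡ g b ⊕ D r′ → ∃[ r′ ] (ZeroOrThree r′ × f (b ⊕ D r) ≡ g b ⊕ D r′)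
    classify (zeroᴰ   , e) = zeroᴰ , isZero , e
    classify (threeᴰ  , e) = threeᴰ , isThree , e
    classify (unitᴰ j , e) = ⊥-elim (not-to-unit b zt j e)
    classify (oneᴰ    , e) = ⊥-elim (not-one zt (⊕D-injective b (f-injective (trans e (sym (f-shift-f₁ b))))))

  Fixes Swaps : G k → Set
  Fixes b = f (b ⊕ 0G) ≡ g b ⊕ 0G × f (b ⊕ f₃) ≡ g b ⊕ f₃
  Swaps b = f (b ⊕ 0G) ≡ g b ⊕ f₃ × f (b ⊕ f₃) ≡ g b ⊕ 0G

  fixes-or-swaps : ∀ b → Fixes b ⊎ Swaps b
  fixes-or-swaps b = combine (zero-or-three-image b isZero) (zero-or-three-image b isThree)
    where
    0≢3 : zeroᴰ ≢ threeᴰ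
    0≢3 ()
    clash : ∀ {r} → f (b ⊕ 0G) ≡ g b ⊕ D r → f (b ⊕ f₃) ≡ g b ⊕ D r → ⊥
    clash e₀ e₃ = 0≢3 (⊕D-injective b (f-injective (trans e₀ (sym e₃))))
    combine : ∃[ r ] (ZeroOrThree r × f (b ⊕ 0G) ≡ g b ⊕ D r) →
              ∃[ r ] (ZeroOrThree r × f (b ⊕ f₃) ≡ g b ⊕ D r) → Fixes b ⊎ Swaps b
    combine (_ , isZero  , e₀) (_ , isThree , e₃) = inj₁ (e₀ , e₃)
    combine (_ , isThree , e₀) (_ , isZero  , e₃) = inj₂ (e₀ , e₃)
    combine (_ , isZero  , e₀) (_ , isZero  , e₃) = ⊥-elim (clash {zeroᴰ} e₀ e₃)
    combine (_ , isThree , e₀) (_ , isThree , e₃) = ⊥-elim (clash {threeᴰ} e₀ e₃)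

  -- Step 4: a swap at b forces a swap at b + f₃ (a fix there would give g (b + f₃) = g b)
  swaps-propagate : ∀ b → Swaps b → Swaps (b ⊕ f₃)
  swaps-propagate b sw = decide (fixes-or-swaps (b ⊕ f₃))
    where
    f₃≢0 : f₃ ≢ 0G {k}
    f₃≢0 ()
    decide : Fixes (b ⊕ f₃) ⊎ Swaps (b ⊕ f₃) → Swaps (b ⊕ f₃)
    decide (inj₂ sw′) = sw′
    decide (inj₁ fx)  = ⊥-elim (f₃≢0 (⊕-fixed b f₃ (g-injective (⊕-cancelʳ _ _ 0G (begin
        g (b ⊕ f₃) ⊕ 0G        ≡⟨ sym (proj₁ fx) ⟩
        f ((b ⊕ f₃) ⊕ 0G)      ≡⟨ cong f (⊕-idʳ (b ⊕ f₃)) ⟩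
        f (b ⊕ f₃)             ≡⟨ proj₂ sw ⟩
        g b ⊕ 0G               ∎)))))

  _+f₃×_ : G k → ℕ → G k
  b +f₃× zero  = b
  b +f₃× suc n = (b +f₃× n) ⊕ f₃

  swaps-iterate : ∀ b n → Swaps b → Swaps (b +f₃× n)
  swaps-iterate b zero    sw = sw
  swaps-iterate b (suc n) sw = swaps-propagate (b +f₃× n) (swaps-iterate b n sw)

  -- Swaps at b, b + f₁ = b + 5f₃ and b + 2f₁ = b + 3f₃, combined with Step 1, give f₃ = 0
  no-swaps : ∀ b → ¬ Swaps b
  no-swaps b sw = -f₃≢0 (sym (⊕-cancelˡ (g b) 0G (⊖ f₃) (begin
      g b ⊕ 0G                                           ≡⟨ sym (proj₂ sw) ⟩
      f (b ⊕ f₃)                                         ≡⟨ cong f (solve (x₀ ⊕' F₃) ((x₀ ⊕' F₁) ⊕' F₁ ⊕' F₁) refl (b ∷ [])) ⟩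
      f (c₂ ⊕ f₁)                                        ≡⟨ f-shift-f₁ c₂ ⟩
      g c₂ ⊕ f₁                                          ≡⟨ cong (_⊕ f₁) (g-step c₁ {3} c₂≡ (f-shift-f₁ c₁)) ⟩
      ((g c₁ ⊕ f₁) ⊕ (⊖ f₃)) ⊕ f₁                        ≡⟨ cong (λ q → ((q ⊕ f₁) ⊕ (⊖ f₃)) ⊕ f₁) (g-step b {5} c₁≡ (f-shift-f₁ b)) ⟩
      ((((g b ⊕ f₁) ⊕ (⊖ f₃)) ⊕ f₁) ⊕ (⊖ f₃)) ⊕ f₁       ≡⟨ solve (((((x₀ ⊕' F₁) ⊕' ⊖' F₃) ⊕' F₁) ⊕' ⊖' F₃) ⊕' F₁) (x₀ ⊕' ⊖' F₃) refl (g b ∷ []) ⟩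
      g b ⊕ (⊖ f₃)                                       ∎)))
    where
    -f₃≢0 : ⊖ f₃ ≢ 0G {k}
    -f₃≢0 ()
    c₁ c₂ : G k
    c₁ = b ⊕ f₁
    c₂ = c₁ ⊕ f₁
    c₁≡ : b +f₃× 5 ≡ c₁
    c₁≡ = solve ((((x₀ ⊕' F₃) ⊕' F₃) ⊕' F₃) ⊕' F₃ ⊕' F₃) (x₀ ⊕' F₁) refl (b ∷ [])
    c₂≡ : b +f₃× 3 ≡ c₂
    c₂≡ = solve ((x₀ ⊕' F₃) ⊕' F₃ ⊕' F₃) ((x₀ ⊕' F₁) ⊕' F₁) refl (b ∷ [])
    g-step : ∀ c {n} → b +f₃× n ≡ c ⊕ f₁ → f (c ⊕ f₁) ≡ g c ⊕ f₁ → g (c ⊕ f₁) ≡ (g c ⊕ f₁) ⊕ (⊖ f₃)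
    g-step c {n} bn≡c+f₁ step = begin
      g (c ⊕ f₁)                          ≡⟨ solve x₀ ((x₀ ⊕' F₃) ⊕' ⊖' F₃) refl (g (c ⊕ f₁) ∷ []) ⟩
      (g (c ⊕ f₁) ⊕ f₃) ⊕ (⊖ f₃)          ≡⟨ cong (_⊕ (⊖ f₃)) (sym (proj₁ (subst Swaps bn≡c+f₁ (swaps-iterate b n sw)))) ⟩
      f ((c ⊕ f₁) ⊕ 0G) ⊕ (⊖ f₃)          ≡⟨ cong (λ q → f q ⊕ (⊖ f₃)) (⊕-idʳ (c ⊕ f₁)) ⟩
      f (c ⊕ f₁) ⊕ (⊖ f₃)                 ≡⟨ cong (_⊕ (⊖ f₃)) step ⟩
      (g c ⊕ f₁) ⊕ (⊖ f₃)                 ∎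

  fixes : ∀ b → Fixes b
  fixes b = decide (fixes-or-swaps b)
    where
    decide : Fixes b ⊎ Swaps b → Fixes b
    decide (inj₁ fx) = fx
    decide (inj₂ sw) = ⊥-elim (no-swaps b sw)

  g≗f : ∀ b → g b ≡ f b
  g≗f b = sym (trans (cong f (sym (⊕-idʳ b))) (trans (proj₁ (fixes b)) (⊕-idʳ (g b))))

  NonUnit : Role k → Set
  NonUnit r = ∀ i → r ≢ unitᴰ i

  f-shift : ∀ b r → NonUnit r → f (b ⊕ D r) ≡ f b ⊕ D r
  f-shift b zeroᴰ     _  = trans (proj₁ (fixes b)) (cong (_⊕ 0G) (g≗f b))
  f-shift b oneᴰ      _  = trans (f-shift-f₁ b) (cong (_⊕ f₁) (g≗f b))
  f-shift b threeᴰ    _  = trans (proj₂ (fixes b)) (cong (_⊕ f₃) (g≗f b))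
  f-shift b (unitᴰ i) nu = ⊥-elim (nu i refl)

  unit-image : ∀ b i → ∃[ j ] f (b ⊕ u i) ≡ f b ⊕ u j
  unit-image b i = classify (image-on-line b (unitᴰ i))
    where
    impossible : ∀ r → NonUnit r → f (b ⊕ u i) ≡ g b ⊕ D r → ⊥
    impossible r nonunit e = nonunit i (sym (⊕D-injective b (f-injective (begin
      f (b ⊕ u i)  ≡⟨ e ⟩
      g b ⊕ D r    ≡⟨ cong (_⊕ D r) (g≗f b) ⟩
      f b ⊕ D r    ≡⟨ sym (f-shift b r nonunit) ⟩
      f (b ⊕ D r)  ∎))))
    classify : ∃[ r ] f (b ⊕ u i) ≡ g b ⊕ D r → ∃[ j ] f (b ⊕ u i) ≡ f b ⊕ u j
    classify (unitᴰ j , e) = j , trans e (cong (_⊕ u j) (g≗f b))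
    classify (zeroᴰ   , e) = ⊥-elim (impossible zeroᴰ  (λ _ ()) e)
    classify (oneᴰ    , e) = ⊥-elim (impossible oneᴰ   (λ _ ()) e)
    classify (threeᴰ  , e) = ⊥-elim (impossible threeᴰ (λ _ ()) e)

  -- Step 6: on the line 0 the unit vectors are permuted, giving σ ∈ Sₖ
  σ-map : Fin k → Fin k
  σ-map i = proj₁ (unit-image 0G i)

  σ-spec : ∀ i → f (0G ⊕ u i) ≡ f 0G ⊕ u (σ-map i)
  σ-spec i = proj₂ (unit-image 0G i)

  σ-injective : ∀ {i i′} → σ-map i ≡ σ-map i′ → i ≡ i′
  σ-injective {i} {i′} σi≡σi′ = u-injective (⊕-cancelˡ 0G (u i) (u i′) (f-injective (begin
    f (0G ⊕ u i)          ≡⟨ σ-spec i ⟩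
    f 0G ⊕ u (σ-map i)    ≡⟨ cong (λ m → f 0G ⊕ u m) σi≡σi′ ⟩
    f 0G ⊕ u (σ-map i′)   ≡⟨ sym (σ-spec i′) ⟩
    f (0G ⊕ u i′)         ∎)))

  -- the preimage of f 0 + eₘ lies on the line 0, and only a unit role fits
  σ-surjective : ∀ m → ∃[ i ] σ-map i ≡ m
  σ-surjective m = from-preimage (f-preimage (f 0G ⊕ u m))
    where
    from-preimage : ∃[ x ] f x ≡ f 0G ⊕ u m → ∃[ i ] σ-map i ≡ m
    from-preimage (x , fx≡) = from-role (incident⇒role x 0G (reflects x 0G fx∈g0))
      where
      fx∈g0 : Incident (f x) (g 0G)
      fx∈g0 = role⇒incident (f x) (g 0G) (unitᴰ m) (trans fx≡ (cong (_⊕ u m) (sym (g≗f 0G))))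
      impossible : ∀ r → NonUnit r → x ≡ 0G ⊕ D r → ⊥
      impossible r nonunit x≡ = nonunit m (⊕D-injective (f 0G) (begin
        f 0G ⊕ D r      ≡⟨ sym (f-shift 0G r nonunit) ⟩
        f (0G ⊕ D r)    ≡⟨ cong f (sym x≡) ⟩
        f x             ≡⟨ fx≡ ⟩
        f 0G ⊕ u m      ∎))
      from-role : ∃[ r ] x ≡ 0G ⊕ D r → ∃[ i ] σ-map i ≡ m
      from-role (unitᴰ i , x≡) = i , u-injective (⊕-cancelˡ (f 0G) _ _ (begin
        f 0G ⊕ u (σ-map i)  ≡⟨ sym (σ-spec i) ⟩
        f (0G ⊕ u i)        ≡⟨ cong f (sym x≡) ⟩
        f x                 ≡⟨ fx≡ ⟩
        f 0G ⊕ u m          ∎))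
      from-role (zeroᴰ  , x≡) = ⊥-elim (impossible zeroᴰ  (λ _ ()) x≡)
      from-role (oneᴰ   , x≡) = ⊥-elim (impossible oneᴰ   (λ _ ()) x≡)
      from-role (threeᴰ , x≡) = ⊥-elim (impossible threeᴰ (λ _ ()) x≡)

  σ : Permutation′ k
  σ = permutation σ-map (λ m → proj₁ (σ-surjective m)) (λ m → proj₂ (σ-surjective m))
                  (λ i → σ-injective (proj₂ (σ-surjective (σ-map i))))

  -- Step 7: the same σ governs the unit steps from every point
  Good : G k → Set
  Good x = ∀ i → f (x ⊕ u i) ≡ f x ⊕ u (σ-map i)

  good-f₁ : ∀ x → Good x → Good (x ⊕ f₁)
  good-f₁ x good i = begin
    f ((x ⊕ f₁) ⊕ u i)          ≡⟨ cong f (solve ((x₀ ⊕' F₁) ⊕' x₁) ((x₀ ⊕' x₁) ⊕' F₁) refl (x ∷ u i ∷ [])) ⟩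
    f ((x ⊕ u i) ⊕ f₁)          ≡⟨ f-shift (x ⊕ u i) oneᴰ (λ _ ()) ⟩
    f (x ⊕ u i) ⊕ f₁            ≡⟨ cong (_⊕ f₁) (good i) ⟩
    (f x ⊕ u (σ-map i)) ⊕ f₁    ≡⟨ solve ((x₀ ⊕' x₁) ⊕' F₁) ((x₀ ⊕' F₁) ⊕' x₁) refl (f x ∷ u (σ-map i) ∷ []) ⟩
    (f x ⊕ f₁) ⊕ u (σ-map i)    ≡⟨ cong (_⊕ u (σ-map i)) (sym (f-shift x oneᴰ (λ _ ()))) ⟩
    f (x ⊕ f₁) ⊕ u (σ-map i)    ∎

  -- around the square x, x + eⱼ, x + eᵢ, x + eᵢ + eⱼ (i ≠ j): eσ(j) + eₘ = eσ(i) + eₘ′ forces m = σ(i)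
  good-other : ∀ x → Good x → ∀ j i → i ≢ j → f ((x ⊕ u j) ⊕ u i) ≡ f (x ⊕ u j) ⊕ u (σ-map i)
  good-other x good j i i≢j = square (unit-image (x ⊕ u j) i) (unit-image (x ⊕ u i) j)
    where
    square : ∃[ m ] f ((x ⊕ u j) ⊕ u i) ≡ f (x ⊕ u j) ⊕ u m →
             ∃[ m′ ] f ((x ⊕ u i) ⊕ u j) ≡ f (x ⊕ u i) ⊕ u m′ →
             f ((x ⊕ u j) ⊕ u i) ≡ f (x ⊕ u j) ⊕ u (σ-map i)
    square (m , em) (m′ , em′) = trans em (cong (λ n → f (x ⊕ u j) ⊕ u n) m≡σi)
      where
      two-ways : f x ⊕ (u (σ-map j) ⊕ u m) ≡ f x ⊕ (u (σ-map i) ⊕ u m′)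
      two-ways = begin
        f x ⊕ (u (σ-map j) ⊕ u m)     ≡⟨ solve (x₀ ⊕' (x₁ ⊕' x₂)) ((x₀ ⊕' x₁) ⊕' x₂) refl (f x ∷ u (σ-map j) ∷ u m ∷ []) ⟩
        (f x ⊕ u (σ-map j)) ⊕ u m     ≡⟨ cong (_⊕ u m) (sym (good j)) ⟩
        f (x ⊕ u j) ⊕ u m             ≡⟨ sym em ⟩
        f ((x ⊕ u j) ⊕ u i)           ≡⟨ cong f (solve ((x₀ ⊕' x₁) ⊕' x₂) ((x₀ ⊕' x₂) ⊕' x₁) refl (x ∷ u j ∷ u i ∷ [])) ⟩
        f ((x ⊕ u i) ⊕ u j)           ≡⟨ em′ ⟩
        f (x ⊕ u i) ⊕ u m′            ≡⟨ cong (_⊕ u m′) (good i) ⟩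
        (f x ⊕ u (σ-map i)) ⊕ u m′    ≡⟨ solve ((x₀ ⊕' x₁) ⊕' x₂) (x₀ ⊕' (x₁ ⊕' x₂)) refl (f x ∷ u (σ-map i) ∷ u m′ ∷ []) ⟩
        f x ⊕ (u (σ-map i) ⊕ u m′)    ∎
      m≡σi : m ≡ σ-map i
      m≡σi = u-sum-cancel (σ-map j) m (σ-map i) m′ (⊕-cancelˡ (f x) _ _ two-ways) (λ σj≡σi → i≢j (sym (σ-injective σj≡σi)))

  -- the step in direction j from x + eⱼ: its target eₘ = e_σ(i′) cannot come from i′ ≠ j
  good-same : ∀ x → Good x → ∀ j → f ((x ⊕ u j) ⊕ u j) ≡ f (x ⊕ u j) ⊕ u (σ-map j)
  good-same x good j = step (unit-image (x ⊕ u j) j)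
    where
    step : ∃[ m ] f ((x ⊕ u j) ⊕ u j) ≡ f (x ⊕ u j) ⊕ u m → f ((x ⊕ u j) ⊕ u j) ≡ f (x ⊕ u j) ⊕ u (σ-map j)
    step (m , em) = trans em (cong (λ n → f (x ⊕ u j) ⊕ u n) (identify (σ-surjective m)))
      where
      identify : ∃[ i′ ] σ-map i′ ≡ m → m ≡ σ-map j
      identify (i′ , σi′≡m) = by-cases (i′ ≟ᶠ j)
        where
        by-cases : Dec (i′ ≡ j) → m ≡ σ-map j
        by-cases (yes i′≡j) = trans (sym σi′≡m) (cong σ-map i′≡j)
        by-cases (no  i′≢j) = ⊥-elim (i′≢j (u-injective (⊕-cancelˡ (x ⊕ u j) _ _ (f-injective (begin
          f ((x ⊕ u j) ⊕ u i′)          ≡⟨ good-other x good j i′ i′≢j ⟩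
          f (x ⊕ u j) ⊕ u (σ-map i′)    ≡⟨ cong (λ n → f (x ⊕ u j) ⊕ u n) σi′≡m ⟩
          f (x ⊕ u j) ⊕ u m             ≡⟨ sym em ⟩
          f ((x ⊕ u j) ⊕ u j)           ∎)))))

  good-u : ∀ x j → Good x → Good (x ⊕ u j)
  good-u x j good i = by-cases (i ≟ᶠ j)
    where
    by-cases : Dec (i ≡ j) → f ((x ⊕ u j) ⊕ u i) ≡ f (x ⊕ u j) ⊕ u (σ-map i)
    by-cases (yes refl) = good-same x good j
    by-cases (no i≢j)   = good-other x good j i i≢j

  -- Step 8: by induction over the generators, f x = σ·x + f 0
  Affine : G k → Set
  Affine x = Good x × f x ≡ act σ x ⊕ f 0G

  affine-0 : Affine 0G
  affine-0 = σ-spec , sym (trans (cong (_⊕ f 0G) (act-C₇ σ zero)) (solve (∅ ⊕' x₀) x₀ refl (f 0G ∷ [])))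

  affine-f₁ : ∀ x → Affine x → Affine (x ⊕ f₁)
  affine-f₁ x (good , fx≡) = good-f₁ x good , (begin
    f (x ⊕ f₁)                           ≡⟨ f-shift x oneᴰ (λ _ ()) ⟩
    f x ⊕ f₁                             ≡⟨ cong (_⊕ f₁) fx≡ ⟩
    (act σ x ⊕ f 0G) ⊕ f₁                ≡⟨ solve ((x₀ ⊕' x₁) ⊕' F₁) ((x₀ ⊕' F₁) ⊕' x₁) refl (act σ x ∷ f 0G ∷ []) ⟩
    (act σ x ⊕ f₁) ⊕ f 0G                ≡⟨ cong (λ w → (act σ x ⊕ w) ⊕ f 0G) (sym (act-C₇ σ (suc zero))) ⟩
    (act σ x ⊕ act σ f₁) ⊕ f 0G          ≡⟨ cong (_⊕ f 0G) (sym (act-⊕ σ x f₁)) ⟩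
    act σ (x ⊕ f₁) ⊕ f 0G                ∎)

  affine-u : ∀ x j → Affine x → Affine (x ⊕ u j)
  affine-u x j (good , fx≡) = good-u x j good , (begin
    f (x ⊕ u j)                          ≡⟨ good j ⟩
    f x ⊕ u (σ-map j)                    ≡⟨ cong (_⊕ u (σ-map j)) fx≡ ⟩
    (act σ x ⊕ f 0G) ⊕ u (σ-map j)       ≡⟨ solve ((x₀ ⊕' x₁) ⊕' x₂) ((x₀ ⊕' x₂) ⊕' x₁) refl (act σ x ∷ f 0G ∷ u (σ-map j) ∷ []) ⟩
    (act σ x ⊕ u (σ-map j)) ⊕ f 0G       ≡⟨ cong (λ w → (act σ x ⊕ w) ⊕ f 0G) (sym (act-u σ j)) ⟩
    (act σ x ⊕ act σ (u j)) ⊕ f 0G       ≡⟨ cong (_⊕ f 0G) (sym (act-⊕ σ x (u j))) ⟩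
    act σ (x ⊕ u j) ⊕ f 0G               ∎)

  is-Φ : (∀ p → f p ≡ Φpt (σ , f 0G) p) × (∀ l → g l ≡ Φln (σ , f 0G) l)
  is-Φ = f≡Φ , λ l → trans (g≗f l) (f≡Φ l)
    where
    f≡Φ : ∀ p → f p ≡ Φpt (σ , f 0G) p
    f≡Φ p = proj₂ (generated Affine affine-0 affine-f₁ affine-u p)

-- Φ : Sₖ ⋉ (C₃ᵏ ⊕ C₇) → Aut 𝔐 is an isomorphism
proposition5p15 : (k : ℕ) → 2 ≤ k →
    -- Φ lands in Aut 𝔐
    (∀ (s : SD k) → IsAut (Φpt s) (Φln s))
    -- Φ is surjective onto Aut 𝔐
    × (∀ (f : Point k → Point k) (g : Line k → Line k) → IsAut f g →
         ∃[ s ] ((∀ p → f p ≡ Φpt s p) × (∀ l → g l ≡ Φln s l)))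
    -- Φ is injective
    × (∀ (s s′ : SD k) → (∀ p → Φpt s p ≡ Φpt s′ p) → (∀ l → Φln s l ≡ Φln s′ l) →
         s ≈SD s′)
    -- Φ is a group homomorphism (Aut composed as functions)
    × (∀ (s s′ : SD k) →
         (∀ p → Φpt (s ·SD s′) p ≡ Φpt s (Φpt s′ p))
         × (∀ l → Φln (s ·SD s′) l ≡ Φln s (Φln s′ l)))
proposition5p15 zero    ()
proposition5p15 (suc k) _ =
    Φ-automorphism
  , (λ f g aut → (Automorphism.σ zero f g aut , f 0G) , Automorphism.is-Φ zero f g aut)
  , (λ s s′ same-points _ → Φ-injective s s′ same-points)
  , (λ s s′ → Φ-homomorphism s s′ , Φ-homomorphism s s′)
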